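{- Let $s$ and $l$ be two positive integers. Let $p$ be an odd prime such that $p\ge l+2$ and $p-1$ divides none of $sl$ and $ks+1$ for $k=1,\dots,l$. Then the homogeneous multiple harmonic sum satisfies $$ H(\{s\}^l; p-1)\equiv S(\{s\}^l; p-1)\equiv 0 \pmod{p^{\mathrm{par}(ls-1)}}. $$ In particular, if $p\ge ls+3$ then the congruence $H(\{s\}^l; p-1)\equiv S(\{s\}^l; p-1)\equiv 0 \pmod{p^{\mathrm{par}(ls-1)}}$ always holds, and so $p\mid H(\{s\}^l; p-1)$.
   Context: For positive integers $s_1,\dots,s_l$ and $n\ge 0$, $H(s_1,\dots,s_l;n)=\sum_{1\le k_1<\dots<k_l\le n} k_1^{ -s_1}\cdots k_l^{ -s_l}$ and $S(s_1,\dots,s_l;n)=\sum_{1\le k_1\le\dots\le k_l\le n} k_1^{ -s_1}\cdots k_l^{ -s_l}$. The notation $\{s\}^l$ denotes the sequence $(s,s,\dots,s)$ with $s$ repeated $l$ times. For an integer $m$, $\mathrm{par}(m)$ (the parity of $m$) is $1$ if $m$ is odd and $2$ if $m$ is even. -}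

module Defs where

open import Data.Nat using (ℕ; zero; suc; _^_)
open import Data.Nat.Divisibility using (_∣_)
open import Data.Nat.Properties using (m^n≢0)
open import Data.Nat.Coprimality using (Coprime)
open import Data.Integer using (+_; ∣_∣)
open import Data.List using (List; []; _∷_; reverse; replicate)
open import Data.Product using (_×_)
open import Data.Rational using (ℚ; 0ℚ; 1ℚ; _+_; _*_; _/_; ↥_; ↧ₙ_)

sumTo : (ℕ → ℚ) → ℕ → ℚ
sumTo f zero    = 0ℚ
sumTo f (suc n) = sumTo f n + f (suc n)

invPow : ℕ → ℕ → ℚ
invPow m s = (+ 1 / (suc m ^ s)) {{m^n≢0 (suc m) s}}

-- Helper: the exponent list is given REVERSED (last exponent s_l first).
-- Hrev (s_l ∷ … ∷ s_1) n = Σ_{k_l=1}^{n} k_l^{-s_l} · Hrev (s_{l-1} … s_1) (k_l - 1)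
Hrev : List ℕ → ℕ → ℚ
Hrev []       n = 1ℚ
Hrev (s ∷ rs) n = sumTo (λ k → term k) n
  where
  term : ℕ → ℚ
  term zero    = 0ℚ
  term (suc m) = invPow m s * Hrev rs m

Srev : List ℕ → ℕ → ℚ
Srev []       n = 1ℚ
Srev (s ∷ rs) n = sumTo (λ k → term k) n
  where
  term : ℕ → ℚ
  term zero    = 0ℚ
  term (suc m) = invPow m s * Srev rs (suc m)

-- H(s_1,…,s_l; n) = Σ_{1 ≤ k_1 < … < k_l ≤ n} k_1^{-s_1} ⋯ k_l^{-s_l}
H : List ℕ → ℕ → ℚ
H ss n = Hrev (reverse ss) n

-- S(s_1,…,s_l; n) = Σ_{1 ≤ k_1 ≤ … ≤ k_l ≤ n} k_1^{-s_1} ⋯ k_l^{-s_l}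
S : List ℕ → ℕ → ℚ
S ss n = Srev (reverse ss) n

rep : ℕ → ℕ → List ℕ
rep s l = replicate l s

par : ℕ → ℕ
par zero          = 2
par (suc zero)    = 1
par (suc (suc m)) = par m

-- x ≡ 0 (mod m) for a rational x: x is m-integral (reduced denominator
-- coprime to m) and m divides the reduced numerator.
_≡0mod_ : ℚ → ℕ → Set
x ≡0mod m = Coprime m (↧ₙ x) × (m ∣ ∣ (↥ x) ∣)

module Submission where

-- With xₖ = 1/k^s (1 ≤ k ≤ p − 1), H({s}^l; p − 1) and S({s}^l; p − 1) are the elementary and complete
-- symmetric functions e_l(x) and h_l(x). Newton's identities express l·e_l and l·h_l through the power sums
-- Σ xₖ^m = Σ k^(−sm), which vanish mod p unless p − 1 | sm; so p divides e_l and h_l when p − 1 ∤ ls.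
-- When ls is odd, the reflection k ↦ p − k gives x_{p−k} ≡ (−1)^s xₖ (1 + sp/k) (mod p²), hence
-- e_l(x) ≡ −e_l(x) + p·D_l (mod p²) with D_l a directional derivative of e_l. Newton's identities for D_l
-- involve only the power sums Σₖ k^(−bs−1) with 1 ≤ b ≤ l, which vanish mod p, so p² | 2e_l; likewise for h_l.

open import Data.Nat as ℕ using (ℕ; zero; suc; z≤n; s≤s; _∸_; _<_; _≤_)
import Data.Nat.Properties as ℕP
open import Data.Product using (_×_; _,_; proj₁; proj₂)
open import Data.Sum using (_⊎_; inj₁; inj₂)
open import Data.Empty using (⊥-elim)
open import Relation.Nullary using (¬_; yes; no)
open import Data.Nat.Primality using (Prime)
open import Relation.Binary.PropositionalEquality

module Arithmetic where

  open import Data.Integer as ℤ using (ℤ; +_)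
  import Data.Integer.Properties as ℤP
  import Data.Integer.Solver as ℤSolver
  open import Data.Rational as ℚ using (ℚ; 0ℚ; 1ℚ; _+_; _*_; _-_; -_; _/_; toℚᵘ)
  import Data.Rational.Properties as ℚP
  open import Data.Rational.Unnormalised as ℚᵘ using (mkℚᵘ; *≡*)
  import Data.Rational.Unnormalised.Properties as ℚᵘP
  open import Data.Rational.Solver using (module +-*-Solver)
  open +-*-Solver
  open import Data.Nat.Combinatorics using (_C_; nC1≡n; k>n⇒nCk≡0; nCk+nC[k+1]≡[n+1]C[k+1])
  open import Data.Nat.Tactic.RingSolver using (solve-∀)
  open import Defs using (invPow)

  ιℤ : ℤ → ℚ
  ιℤ i = i / 1

  ι : ℕ → ℚ
  ι n = ιℤ (+ n)

  private
    toℚᵘ-ιℤ : ∀ i → toℚᵘ (ιℤ i) ℚᵘ.≃ mkℚᵘ i 0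
    toℚᵘ-ιℤ i = ℚP.toℚᵘ-fromℚᵘ (mkℚᵘ i 0)

    module ℤS = ℤSolver.+-*-Solver

  ιℤ-+ : ∀ i j → ιℤ (i ℤ.+ j) ≡ ιℤ i + ιℤ j
  ιℤ-+ i j = ℚP.toℚᵘ-injective (begin
    toℚᵘ (ιℤ (i ℤ.+ j))                ≈⟨ toℚᵘ-ιℤ (i ℤ.+ j) ⟩
    mkℚᵘ (i ℤ.+ j) 0                   ≈⟨ *≡* (identity i j) ⟩
    mkℚᵘ i 0 ℚᵘ.+ mkℚᵘ j 0             ≈⟨ ℚᵘP.+-cong (ℚᵘP.≃-sym (toℚᵘ-ιℤ i)) (ℚᵘP.≃-sym (toℚᵘ-ιℤ j)) ⟩
    toℚᵘ (ιℤ i) ℚᵘ.+ toℚᵘ (ιℤ j)       ≈⟨ ℚᵘP.≃-sym (ℚP.toℚᵘ-homo-+ (ιℤ i) (ιℤ j)) ⟩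
    toℚᵘ (ιℤ i + ιℤ j)                 ∎)
    where
    open ℚᵘP.≃-Reasoning
    identity : ∀ i j → (i ℤ.+ j) ℤ.* (+ 1 ℤ.* + 1) ≡ (i ℤ.* + 1 ℤ.+ j ℤ.* + 1) ℤ.* + 1
    identity = ℤS.solve 2 (λ i j → (i ℤS.:+ j) ℤS.:* (ℤS.con (+ 1) ℤS.:* ℤS.con (+ 1))
                                  ℤS.:= (i ℤS.:* ℤS.con (+ 1) ℤS.:+ j ℤS.:* ℤS.con (+ 1)) ℤS.:* ℤS.con (+ 1)) refl

  ιℤ-* : ∀ i j → ιℤ (i ℤ.* j) ≡ ιℤ i * ιℤ j
  ιℤ-* i j = ℚP.toℚᵘ-injective (begin
    toℚᵘ (ιℤ (i ℤ.* j))                ≈⟨ toℚᵘ-ιℤ (i ℤ.* j) ⟩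
    mkℚᵘ (i ℤ.* j) 0                   ≈⟨ *≡* refl ⟩
    mkℚᵘ i 0 ℚᵘ.* mkℚᵘ j 0             ≈⟨ ℚᵘP.*-cong (ℚᵘP.≃-sym (toℚᵘ-ιℤ i)) (ℚᵘP.≃-sym (toℚᵘ-ιℤ j)) ⟩
    toℚᵘ (ιℤ i) ℚᵘ.* toℚᵘ (ιℤ j)       ≈⟨ ℚᵘP.≃-sym (ℚP.toℚᵘ-homo-* (ιℤ i) (ιℤ j)) ⟩
    toℚᵘ (ιℤ i * ιℤ j)                 ∎)
    where open ℚᵘP.≃-Reasoning

  ιℤ-neg : ∀ i → ιℤ (ℤ.- i) ≡ - ιℤ i
  ιℤ-neg i = ℚP.toℚᵘ-injective (begin
    toℚᵘ (ιℤ (ℤ.- i))                  ≈⟨ toℚᵘ-ιℤ (ℤ.- i) ⟩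
    mkℚᵘ (ℤ.- i) 0                     ≈⟨ ℚᵘP.-‿cong (ℚᵘP.≃-sym (toℚᵘ-ιℤ i)) ⟩
    ℚᵘ.- toℚᵘ (ιℤ i)                   ≈⟨ ℚᵘP.≃-sym (ℚP.toℚᵘ-homo‿- (ιℤ i)) ⟩
    toℚᵘ (- ιℤ i)                      ∎)
    where open ℚᵘP.≃-Reasoning

  ι-suc≢0 : ∀ n → ι (suc n) ≢ 0ℚ
  ι-suc≢0 n eq with ℚᵘP.≃-trans (ℚᵘP.≃-sym (toℚᵘ-ιℤ (+ suc n))) (ℚP.toℚᵘ-cong eq)
  ... | *≡* ()

  /-*-ι : ∀ i d → (i / suc d) * ι (suc d) ≡ ιℤ i
  /-*-ι i d = ℚP.toℚᵘ-injective (begin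
    toℚᵘ ((i / suc d) * ι (suc d))         ≈⟨ ℚP.toℚᵘ-homo-* (i / suc d) (ι (suc d)) ⟩
    toℚᵘ (i / suc d) ℚᵘ.* toℚᵘ (ι (suc d)) ≈⟨ ℚᵘP.*-cong (ℚP.toℚᵘ-fromℚᵘ (mkℚᵘ i d)) (toℚᵘ-ιℤ (+ suc d)) ⟩
    mkℚᵘ i d ℚᵘ.* mkℚᵘ (+ suc d) 0         ≈⟨ *≡* (identity i d) ⟩
    mkℚᵘ i 0                               ≈⟨ ℚᵘP.≃-sym (toℚᵘ-ιℤ i) ⟩
    toℚᵘ (ιℤ i)                            ∎)
    where
    open ℚᵘP.≃-Reasoning
    identity : ∀ i d → i ℤ.* + suc d ℤ.* + 1 ≡ i ℤ.* + suc (d ℕ.* 1)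
    identity i d rewrite ℕP.*-identityʳ d = ℤP.*-identityʳ (i ℤ.* + suc d)

  open ≡-Reasoning

  ι-+ : ∀ m n → ι (m ℕ.+ n) ≡ ι m + ι n
  ι-+ m n = trans (cong ιℤ (ℤP.pos-+ m n)) (ιℤ-+ (+ m) (+ n))

  ι-* : ∀ m n → ι (m ℕ.* n) ≡ ι m * ι n
  ι-* m n = trans (cong ιℤ (ℤP.pos-* m n)) (ιℤ-* (+ m) (+ n))

  ι-suc : ∀ n → ι (suc n) ≡ 1ℚ + ι n
  ι-suc = ι-+ 1

  *-cancelʳ-ι : ∀ {q r} n → q * ι (suc n) ≡ r * ι (suc n) → q ≡ r
  *-cancelʳ-ι {q} {r} n eq = begin
    q                   ≡⟨ ℚP.*-identityʳ q ⟨
    q * 1ℚ              ≡⟨ cong (q *_) (ℚP.*-inverseʳ x) ⟨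
    q * (x * ℚ.1/ x)    ≡⟨ ℚP.*-assoc q x (ℚ.1/ x) ⟨
    (q * x) * ℚ.1/ x    ≡⟨ cong (_* ℚ.1/ x) eq ⟩
    (r * x) * ℚ.1/ x    ≡⟨ ℚP.*-assoc r x (ℚ.1/ x) ⟩
    r * (x * ℚ.1/ x)    ≡⟨ cong (r *_) (ℚP.*-inverseʳ x) ⟩
    r * 1ℚ              ≡⟨ ℚP.*-identityʳ r ⟩
    r                   ∎
    where
    x : ℚ
    x = ι (suc n)
    instance
      x≢0 : ℚ.NonZero x
      x≢0 = ℚ.≢-nonZero (ι-suc≢0 n)

  infixr 8 _^ℚ_

  _^ℚ_ : ℚ → ℕ → ℚ
  x ^ℚ zero  = 1ℚ
  x ^ℚ suc n = x * x ^ℚ n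

  ^ℚ-distribʳ-* : ∀ a b n → (a * b) ^ℚ n ≡ a ^ℚ n * b ^ℚ n
  ^ℚ-distribʳ-* a b zero    = refl
  ^ℚ-distribʳ-* a b (suc n) = trans (cong ((a * b) *_) (^ℚ-distribʳ-* a b n))
    (solve 4 (λ a b x y → (a :* b) :* (x :* y) := (a :* x) :* (b :* y)) refl a b (a ^ℚ n) (b ^ℚ n))

  ^ℚ-distribˡ-+-* : ∀ a m n → a ^ℚ (m ℕ.+ n) ≡ a ^ℚ m * a ^ℚ n
  ^ℚ-distribˡ-+-* a zero    n = sym (ℚP.*-identityˡ (a ^ℚ n))
  ^ℚ-distribˡ-+-* a (suc m) n = trans (cong (a *_) (^ℚ-distribˡ-+-* a m n)) (sym (ℚP.*-assoc a (a ^ℚ m) (a ^ℚ n)))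

  1^ℚn≡1 : ∀ n → 1ℚ ^ℚ n ≡ 1ℚ
  1^ℚn≡1 zero    = refl
  1^ℚn≡1 (suc n) = cong (1ℚ *_) (1^ℚn≡1 n)

  ^ℚ-*-assoc : ∀ a m n → (a ^ℚ m) ^ℚ n ≡ a ^ℚ (m ℕ.* n)
  ^ℚ-*-assoc a m zero    = cong (a ^ℚ_) (sym (ℕP.*-zeroʳ m))
  ^ℚ-*-assoc a m (suc n) = begin
    a ^ℚ m * (a ^ℚ m) ^ℚ n   ≡⟨ cong (a ^ℚ m *_) (^ℚ-*-assoc a m n) ⟩
    a ^ℚ m * a ^ℚ (m ℕ.* n)  ≡⟨ ^ℚ-distribˡ-+-* a m (m ℕ.* n) ⟨
    a ^ℚ (m ℕ.+ m ℕ.* n)     ≡⟨ cong (a ^ℚ_) (ℕP.*-suc m n) ⟨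
    a ^ℚ (m ℕ.* suc n)       ∎

  ι-^ : ∀ k s → ι (k ℕ.^ s) ≡ ι k ^ℚ s
  ι-^ k zero    = refl
  ι-^ k (suc s) = trans (ι-* k (k ℕ.^ s)) (cong (ι k *_) (ι-^ k s))

  neg-^ℚ : ∀ a b → (- a) ^ℚ b ≡ (- 1ℚ) ^ℚ b * a ^ℚ b
  neg-^ℚ a b = trans (cong (_^ℚ b) (solve 1 (λ a → :- a := (:- con 1ℚ) :* a) refl a)) (^ℚ-distribʳ-* (- 1ℚ) a b)

  [-1]^odd≡-1 : ∀ k → (- 1ℚ) ^ℚ suc (k ℕ.+ k) ≡ - 1ℚ
  [-1]^odd≡-1 zero    = refl
  [-1]^odd≡-1 (suc k) = begin
    (- 1ℚ) ^ℚ suc (suc k ℕ.+ suc k)                ≡⟨ cong (λ t → (- 1ℚ) ^ℚ suc (suc t)) (ℕP.+-suc k k) ⟩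
    - 1ℚ * (- 1ℚ * (- 1ℚ) ^ℚ suc (k ℕ.+ k))        ≡⟨ cong (λ t → - 1ℚ * (- 1ℚ * t)) ([-1]^odd≡-1 k) ⟩
    - 1ℚ * (- 1ℚ * - 1ℚ)                           ≡⟨⟩
    - 1ℚ                                           ∎

  inverse-unique : ∀ a b c → a * c ≡ 1ℚ → b * c ≡ 1ℚ → a ≡ b
  inverse-unique a b c ac≡1 bc≡1 = begin
    a            ≡⟨ ℚP.*-identityʳ a ⟨
    a * 1ℚ       ≡⟨ cong (a *_) bc≡1 ⟨
    a * (b * c)  ≡⟨ solve 3 (λ a b c → a :* (b :* c) := b :* (a :* c)) refl a b c ⟩
    b * (a * c)  ≡⟨ cong (b *_) ac≡1 ⟩
    b * 1ℚ       ≡⟨ ℚP.*-identityʳ b ⟩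
    b            ∎

  invPow-*-ι^ : ∀ m s → invPow m s * ι (suc m ℕ.^ s) ≡ 1ℚ
  invPow-*-ι^ m s = helper (suc m ℕ.^ s) {{ℕP.m^n≢0 (suc m) s}}
    where
    helper : ∀ N .{{_ : ℕ.NonZero N}} → (+ 1 / N) * ι N ≡ 1ℚ
    helper (suc d) = /-*-ι (+ 1) d

  1/[1+_] : ℕ → ℚ
  1/[1+ m ] = invPow m 1

  1/[1+]-*-ι : ∀ m → 1/[1+ m ] * ι (suc m) ≡ 1ℚ
  1/[1+]-*-ι m = trans (cong (λ k → invPow m 1 * ι k) (sym (ℕP.*-identityʳ (suc m)))) (invPow-*-ι^ m 1)

  invPow≡1/[1+]^ : ∀ m s → invPow m s ≡ 1/[1+ m ] ^ℚ s
  invPow≡1/[1+]^ m s = inverse-unique _ _ (ι (suc m ℕ.^ s)) (invPow-*-ι^ m s) (begin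
    y ^ℚ s * ι (suc m ℕ.^ s)      ≡⟨ cong (y ^ℚ s *_) (ι-^ (suc m) s) ⟩
    y ^ℚ s * ι (suc m) ^ℚ s       ≡⟨ ^ℚ-distribʳ-* y (ι (suc m)) s ⟨
    (y * ι (suc m)) ^ℚ s          ≡⟨ cong (_^ℚ s) (1/[1+]-*-ι m) ⟩
    1ℚ ^ℚ s                       ≡⟨ 1^ℚn≡1 s ⟩
    1ℚ                            ∎)
    where
    y : ℚ
    y = 1/[1+ m ]

  sum< : (ℕ → ℚ) → ℕ → ℚ
  sum< f zero    = 0ℚ
  sum< f (suc n) = sum< f n + f n

  sum<-cong : ∀ {f g} n → (∀ {j} → j < n → f j ≡ g j) → sum< f n ≡ sum< g n
  sum<-cong zero    f≡g = refl
  sum<-cong (suc n) f≡g = cong₂ _+_ (sum<-cong n (λ j<n → f≡g (ℕP.m<n⇒m<1+n j<n))) (f≡g ℕP.≤-refl)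

  sum<-+ : ∀ f g n → sum< (λ j → f j + g j) n ≡ sum< f n + sum< g n
  sum<-+ f g zero    = refl
  sum<-+ f g (suc n) = trans (cong (_+ (f n + g n)) (sum<-+ f g n))
    (solve 4 (λ a b c d → (a :+ b) :+ (c :+ d) := (a :+ c) :+ (b :+ d)) refl (sum< f n) (sum< g n) (f n) (g n))

  sum<-*ˡ : ∀ c f n → sum< (λ j → c * f j) n ≡ c * sum< f n
  sum<-*ˡ c f zero    = sym (ℚP.*-zeroʳ c)
  sum<-*ˡ c f (suc n) = trans (cong (_+ c * f n) (sum<-*ˡ c f n)) (sym (ℚP.*-distribˡ-+ c (sum< f n) (f n)))

  sum<-0 : ∀ n → sum< (λ _ → 0ℚ) n ≡ 0ℚ
  sum<-0 zero    = refl
  sum<-0 (suc n) = cong (_+ 0ℚ) (sum<-0 n)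

  sum<-1 : ∀ n → sum< (λ _ → 1ℚ) n ≡ ι n
  sum<-1 zero    = refl
  sum<-1 (suc n) = trans (cong (_+ 1ℚ) (sum<-1 n)) (trans (ℚP.+-comm (ι n) 1ℚ) (sym (ι-suc n)))

  sum<-suc : ∀ f n → sum< f (suc n) ≡ f 0 + sum< (λ j → f (suc j)) n
  sum<-suc f zero    = trans (ℚP.+-identityˡ (f 0)) (sym (ℚP.+-identityʳ (f 0)))
  sum<-suc f (suc n) = trans (cong (_+ f (suc n)) (sum<-suc f n)) (ℚP.+-assoc (f 0) _ (f (suc n)))

  sum<-comm : ∀ (g : ℕ → ℕ → ℚ) m n → sum< (λ k → sum< (g k) n) m ≡ sum< (λ j → sum< (λ k → g k j) m) n
  sum<-comm g zero    n = sym (sum<-0 n)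
  sum<-comm g (suc m) n = begin
    sum< (λ k → sum< (g k) n) m + sum< (g m) n                 ≡⟨ cong (_+ sum< (g m) n) (sum<-comm g m n) ⟩
    sum< (λ j → sum< (λ k → g k j) m) n + sum< (g m) n         ≡⟨ sum<-+ (λ j → sum< (λ k → g k j) m) (g m) n ⟨
    sum< (λ j → sum< (λ k → g k j) m + g m j) n                ∎

  sum<-telescope : ∀ f n → sum< (λ k → f (suc k)) n + f 0 ≡ sum< f n + f n
  sum<-telescope f zero    = refl
  sum<-telescope f (suc n) = begin
    sum< f′ n + f (suc n) + f 0     ≡⟨ solve 3 (λ a b c → a :+ b :+ c := a :+ c :+ b) refl (sum< f′ n) (f (suc n)) (f 0) ⟩
    sum< f′ n + f 0 + f (suc n)     ≡⟨ cong (_+ f (suc n)) (sum<-telescope f n) ⟩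
    sum< f n + f n + f (suc n)      ∎
    where
    f′ : ℕ → ℚ
    f′ k = f (suc k)

  suc-C-suc : ∀ n k → suc n C suc k ≡ n C k ℕ.+ n C suc k
  suc-C-suc n k = sym (nCk+nC[k+1]≡[n+1]C[k+1] n k)

  nC[1+n]≡0 : ∀ n → n C suc n ≡ 0
  nC[1+n]≡0 n = k>n⇒nCk≡0 (ℕP.n<1+n n)

  [1+k]*[1+n]C[1+k] : ∀ n k → suc k ℕ.* (suc n C suc k) ≡ suc n ℕ.* (n C k)
  [1+k]*[1+n]C[1+k] zero    zero    = refl
  [1+k]*[1+n]C[1+k] zero    (suc k) = ℕP.*-zeroʳ (suc (suc k))
  [1+k]*[1+n]C[1+k] (suc n) zero    = trans (ℕP.*-identityˡ _) (trans (nC1≡n (suc (suc n))) (sym (ℕP.*-identityʳ _)))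
  [1+k]*[1+n]C[1+k] (suc n) (suc k) = begin
    (2 ℕ.+ k) ℕ.* (suc (suc n) C suc (suc k))           ≡⟨ cong ((2 ℕ.+ k) ℕ.*_) (suc-C-suc (suc n) (suc k)) ⟩
    (2 ℕ.+ k) ℕ.* (c ℕ.+ d)                             ≡⟨ expand k c d ⟩
    suc k ℕ.* c ℕ.+ c ℕ.+ (2 ℕ.+ k) ℕ.* d               ≡⟨ cong₂ (λ u v → u ℕ.+ c ℕ.+ v) ([1+k]*[1+n]C[1+k] n k) ([1+k]*[1+n]C[1+k] n (suc k)) ⟩
    suc n ℕ.* a ℕ.+ c ℕ.+ suc n ℕ.* b                   ≡⟨ cong (λ t → suc n ℕ.* a ℕ.+ t ℕ.+ suc n ℕ.* b) (suc-C-suc n k) ⟩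
    suc n ℕ.* a ℕ.+ (a ℕ.+ b) ℕ.+ suc n ℕ.* b           ≡⟨ collect n a b ⟩
    (2 ℕ.+ n) ℕ.* (a ℕ.+ b)                             ≡⟨ cong ((2 ℕ.+ n) ℕ.*_) (suc-C-suc n k) ⟨
    (2 ℕ.+ n) ℕ.* c                                     ∎
    where
    a b c d : ℕ
    a = n C k
    b = n C suc k
    c = suc n C suc k
    d = suc n C suc (suc k)
    expand : ∀ k c d → (2 ℕ.+ k) ℕ.* (c ℕ.+ d) ≡ suc k ℕ.* c ℕ.+ c ℕ.+ (2 ℕ.+ k) ℕ.* d
    expand = solve-∀
    collect : ∀ n a b → suc n ℕ.* a ℕ.+ (a ℕ.+ b) ℕ.+ suc n ℕ.* b ≡ (2 ℕ.+ n) ℕ.* (a ℕ.+ b)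
    collect = solve-∀

  binomial : ∀ x m → (x + 1ℚ) ^ℚ m ≡ sum< (λ j → ι (m C j) * x ^ℚ j) (suc m)
  binomial x zero    = refl
  binomial x (suc m) = begin
    (x + 1ℚ) * (x + 1ℚ) ^ℚ m                                     ≡⟨ cong ((x + 1ℚ) *_) (binomial x m) ⟩
    (x + 1ℚ) * sum< t (suc m)                                    ≡⟨ ℚP.*-distribʳ-+ (sum< t (suc m)) x 1ℚ ⟩
    x * sum< t (suc m) + 1ℚ * sum< t (suc m)                      ≡⟨ cong₂ _+_ (sym (sum<-*ˡ x t (suc m))) (trans (ℚP.*-identityˡ _) (sym last≡0)) ⟩
    sum< (λ j → x * t j) (suc m) + sum< t (suc (suc m))           ≡⟨ cong (λ z → sum< (λ j → x * t j) (suc m) + z) (sum<-suc t (suc m)) ⟩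
    sum< (λ j → x * t j) (suc m) + (t 0 + sum< (λ j → t (suc j)) (suc m))
                                                                  ≡⟨ solve 3 (λ a b c → a :+ (b :+ c) := b :+ (a :+ c)) refl
                                                                       (sum< (λ j → x * t j) (suc m)) (t 0) (sum< (λ j → t (suc j)) (suc m)) ⟩
    t 0 + (sum< (λ j → x * t j) (suc m) + sum< (λ j → t (suc j)) (suc m))
                                                                  ≡⟨ cong (λ z → t 0 + z) (sum<-+ (λ j → x * t j) (λ j → t (suc j)) (suc m)) ⟨
    t 0 + sum< (λ j → x * t j + t (suc j)) (suc m)                ≡⟨ cong (λ z → t 0 + z) (sum<-cong (suc m) (λ {j} _ → pascal j)) ⟩
    t′ 0 + sum< (λ j → t′ (suc j)) (suc m)                        ≡⟨ sum<-suc t′ (suc m) ⟨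
    sum< t′ (suc (suc m))                                         ∎
    where
    t t′ : ℕ → ℚ
    t  j = ι (m C j) * x ^ℚ j
    t′ j = ι (suc m C j) * x ^ℚ j
    last≡0 : sum< t (suc (suc m)) ≡ sum< t (suc m)
    last≡0 = begin
      sum< t (suc m) + ι (m C suc m) * x ^ℚ suc m   ≡⟨ cong (λ c → sum< t (suc m) + ι c * x ^ℚ suc m) (nC[1+n]≡0 m) ⟩
      sum< t (suc m) + 0ℚ * x ^ℚ suc m              ≡⟨ solve 2 (λ a b → a :+ con 0ℚ :* b := a) refl (sum< t (suc m)) (x ^ℚ suc m) ⟩
      sum< t (suc m)                                ∎
    pascal : ∀ j → x * t j + t (suc j) ≡ t′ (suc j)
    pascal j = begin
      x * (ι (m C j) * x ^ℚ j) + ι (m C suc j) * (x * x ^ℚ j)  ≡⟨ solve 4 (λ x a b w → x :* (a :* w) :+ b :* (x :* w) := (a :+ b) :* (x :* w))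
                                                                    refl x (ι (m C j)) (ι (m C suc j)) (x ^ℚ j) ⟩
      (ι (m C j) + ι (m C suc j)) * (x * x ^ℚ j)               ≡⟨ cong (_* (x * x ^ℚ j)) (trans (sym (ι-+ (m C j) (m C suc j))) (cong ι (sym (suc-C-suc m j)))) ⟩
      t′ (suc j)                                               ∎

module SymmetricFunctions where

  open Arithmetic
  open import Data.Rational as ℚ using (ℚ; 0ℚ; 1ℚ; _+_; _*_; _-_; -_)
  import Data.Rational.Properties as ℚP
  open import Data.Rational.Solver using (module +-*-Solver)
  open +-*-Solver
  open import Data.List using (List; []; _∷_; map; applyDownFrom; applyUpTo)
  import Data.List.Properties as List
  open import Data.List.Relation.Unary.All using (All; []; _∷_)
  open import Data.List.Relation.Binary.Pointwise using (Pointwise; []; _∷_)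
  open import Data.List.Relation.Binary.Permutation.Propositional as ↭ using (_↭_)
  open ≡-Reasoning

  infix 7 _⋆_

  -- (f ⋆ g) j = Σ_{a+b=j} f a · g b
  _⋆_ : (ℕ → ℚ) → (ℕ → ℚ) → ℕ → ℚ
  (f ⋆ g) zero    = f 0 * g 0
  (f ⋆ g) (suc j) = f (suc j) * g 0 + (f ⋆ (λ i → g (suc i))) j

  ⋆-cong : ∀ {f f′ g g′} j → (∀ i → f i ≡ f′ i) → (∀ i → g i ≡ g′ i) → (f ⋆ g) j ≡ (f′ ⋆ g′) j
  ⋆-cong zero    f≡ g≡ = cong₂ _*_ (f≡ 0) (g≡ 0)
  ⋆-cong (suc j) f≡ g≡ = cong₂ _+_ (cong₂ _*_ (f≡ (suc j)) (g≡ 0)) (⋆-cong j f≡ (λ i → g≡ (suc i)))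

  ⋆-distribʳ-+ : ∀ f f′ g j → ((λ i → f i + f′ i) ⋆ g) j ≡ (f ⋆ g) j + (f′ ⋆ g) j
  ⋆-distribʳ-+ f f′ g zero    = ℚP.*-distribʳ-+ (g 0) (f 0) (f′ 0)
  ⋆-distribʳ-+ f f′ g (suc j) = trans (cong₂ _+_ (ℚP.*-distribʳ-+ (g 0) (f (suc j)) (f′ (suc j))) (⋆-distribʳ-+ f f′ (λ i → g (suc i)) j))
    (solve 4 (λ a b c d → (a :+ b) :+ (c :+ d) := (a :+ c) :+ (b :+ d)) refl
      (f (suc j) * g 0) (f′ (suc j) * g 0) ((f ⋆ (λ i → g (suc i))) j) ((f′ ⋆ (λ i → g (suc i))) j))

  ⋆-distribˡ-+ : ∀ f g g′ j → (f ⋆ (λ i → g i + g′ i)) j ≡ (f ⋆ g) j + (f ⋆ g′) j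
  ⋆-distribˡ-+ f g g′ zero    = ℚP.*-distribˡ-+ (f 0) (g 0) (g′ 0)
  ⋆-distribˡ-+ f g g′ (suc j) = trans (cong₂ _+_ (ℚP.*-distribˡ-+ (f (suc j)) (g 0) (g′ 0)) (⋆-distribˡ-+ f (λ i → g (suc i)) (λ i → g′ (suc i)) j))
    (solve 4 (λ a b c d → (a :+ b) :+ (c :+ d) := (a :+ c) :+ (b :+ d)) refl
      (f (suc j) * g 0) (f (suc j) * g′ 0) ((f ⋆ (λ i → g (suc i))) j) ((f ⋆ (λ i → g′ (suc i))) j))

  ⋆-*ˡ : ∀ c f g j → ((λ i → c * f i) ⋆ g) j ≡ c * (f ⋆ g) j
  ⋆-*ˡ c f g zero    = ℚP.*-assoc c (f 0) (g 0)
  ⋆-*ˡ c f g (suc j) = trans (cong₂ _+_ (ℚP.*-assoc c (f (suc j)) (g 0)) (⋆-*ˡ c f (λ i → g (suc i)) j)) (sym (ℚP.*-distribˡ-+ c _ _))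

  ⋆-*ʳ : ∀ c f g j → (f ⋆ (λ i → c * g i)) j ≡ c * (f ⋆ g) j
  ⋆-*ʳ c f g zero    = solve 3 (λ c a b → a :* (c :* b) := c :* (a :* b)) refl c (f 0) (g 0)
  ⋆-*ʳ c f g (suc j) = trans (cong₂ _+_ (solve 3 (λ c a b → a :* (c :* b) := c :* (a :* b)) refl c (f (suc j)) (g 0)) (⋆-*ʳ c f (λ i → g (suc i)) j))
    (sym (ℚP.*-distribˡ-+ c _ _))

  ⋆-zeroʳ : ∀ f j → (f ⋆ (λ _ → 0ℚ)) j ≡ 0ℚ
  ⋆-zeroʳ f zero    = ℚP.*-zeroʳ (f 0)
  ⋆-zeroʳ f (suc j) = trans (cong₂ _+_ (ℚP.*-zeroʳ (f (suc j))) (⋆-zeroʳ f j)) (ℚP.+-identityˡ 0ℚ)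

  -- Multiplication of a generating function by X.
  shift : (ℕ → ℚ) → ℕ → ℚ
  shift f zero    = 0ℚ
  shift f (suc i) = f i

  shift-⋆-zero : ∀ f g → (shift f ⋆ g) 0 ≡ 0ℚ
  shift-⋆-zero f g = ℚP.*-zeroˡ (g 0)

  shift-⋆-suc : ∀ f g j → (shift f ⋆ g) (suc j) ≡ (f ⋆ g) j
  shift-⋆-suc f g zero    = trans (cong (f 0 * g 0 +_) (ℚP.*-zeroˡ (g 1))) (ℚP.+-identityʳ _)
  shift-⋆-suc f g (suc j) = cong (f (suc j) * g 0 +_) (shift-⋆-suc f (λ i → g (suc i)) j)

  ⋆-geometric-suc : ∀ f b c j → (f ⋆ (λ i → b * c ^ℚ i)) (suc j) ≡ f (suc j) * (b * 1ℚ) + c * (f ⋆ (λ i → b * c ^ℚ i)) j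
  ⋆-geometric-suc f b c j = cong (f (suc j) * (b * 1ℚ) +_)
    (trans (⋆-cong j (λ _ → refl) (λ i → solve 3 (λ b c w → b :* (c :* w) := c :* (b :* w)) refl b c (c ^ℚ i)))
           (⋆-*ʳ c f (λ i → b * c ^ℚ i) j))

  -- As power series: (1 + aX) F · b / (1 + aX) = b F.
  [1+aX]⋆geometric : ∀ f a b j → ((λ i → f i + a * shift f i) ⋆ (λ i → b * (- a) ^ℚ i)) j ≡ b * f j
  [1+aX]⋆geometric f a b zero    = solve 3 (λ f a b → (f :+ a :* con 0ℚ) :* (b :* con 1ℚ) := b :* f) refl (f 0) a b
  [1+aX]⋆geometric f a b (suc j) = begin
    (f′ ⋆ g) (suc j)                                                   ≡⟨ ⋆-geometric-suc f′ b (- a) j ⟩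
    f′ (suc j) * (b * 1ℚ) + (- a) * (f′ ⋆ g) j                          ≡⟨ cong (λ z → f′ (suc j) * (b * 1ℚ) + (- a) * z) ([1+aX]⋆geometric f a b j) ⟩
    (f (suc j) + a * f j) * (b * 1ℚ) + (- a) * (b * f j)                ≡⟨ solve 4 (λ x y a b → (x :+ a :* y) :* (b :* con 1ℚ) :+ (:- a) :* (b :* y) := b :* x)
                                                                            refl (f (suc j)) (f j) a b ⟩
    b * f (suc j)                                                      ∎
    where
    f′ g : ℕ → ℚ
    f′ i = f i + a * shift f i
    g  i = b * (- a) ^ℚ i

  esym : ℕ → List ℚ → ℚ
  esym zero    L       = 1ℚ
  esym (suc j) []      = 0ℚ
  esym (suc j) (a ∷ L) = esym (suc j) L + a * esym j L

  hsym : ℕ → List ℚ → ℚ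
  hsym zero    L       = 1ℚ
  hsym (suc j) []      = 0ℚ
  hsym (suc j) (a ∷ L) = hsym (suc j) L + a * hsym j (a ∷ L)

  -- For L = [(aᵢ , bᵢ)], ∂esym j L = Σᵢ bᵢ ∂esym/∂aᵢ at (aᵢ); likewise ∂hsym.
  ∂esym : ℕ → List (ℚ × ℚ) → ℚ
  ∂esym zero    L             = 0ℚ
  ∂esym (suc j) []            = 0ℚ
  ∂esym (suc j) ((a , b) ∷ L) = ∂esym (suc j) L + a * ∂esym j L + b * esym j (map proj₁ L)

  ∂hsym : ℕ → List (ℚ × ℚ) → ℚ
  ∂hsym zero    L             = 0ℚ
  ∂hsym (suc j) []            = 0ℚ
  ∂hsym (suc j) ((a , b) ∷ L) = ∂hsym (suc j) L + a * ∂hsym j ((a , b) ∷ L) + b * hsym j (a ∷ map proj₁ L)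

  weightedPowerSum : List (ℚ × ℚ) → ℕ → ℚ
  weightedPowerSum []            i = 0ℚ
  weightedPowerSum ((a , b) ∷ L) i = b * a ^ℚ i + weightedPowerSum L i

  weightedPowerSum⁻ : List (ℚ × ℚ) → ℕ → ℚ
  weightedPowerSum⁻ []            i = 0ℚ
  weightedPowerSum⁻ ((a , b) ∷ L) i = b * (- a) ^ℚ i + weightedPowerSum⁻ L i

  private
    esym-∷ : ∀ a L i → esym i (a ∷ L) ≡ esym i L + a * shift (λ k → esym k L) i
    esym-∷ a L zero    = solve 1 (λ a → con 1ℚ := con 1ℚ :+ a :* con 0ℚ) refl a
    esym-∷ a L (suc i) = refl

    hsym-∷ : ∀ a L i → hsym i (a ∷ L) ≡ hsym i L + a * shift (λ k → hsym k (a ∷ L)) i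
    hsym-∷ a L zero    = solve 1 (λ a → con 1ℚ := con 1ℚ :+ a :* con 0ℚ) refl a
    hsym-∷ a L (suc i) = refl

  -- For E(t) = Π (1 + aᵢ t), the derivative is t E(t) Σ bᵢ / (1 + aᵢ t); dually for H(t) = Π 1 / (1 − aᵢ t).
  ∂esym-newton : ∀ L j → ∂esym (suc j) L ≡ ((λ i → esym i (map proj₁ L)) ⋆ weightedPowerSum⁻ L) j
  ∂esym-newton []            j = sym (⋆-zeroʳ _ j)
  ∂esym-newton ((a , b) ∷ L) j = sym (begin
    (e′ ⋆ (λ i → g i + weightedPowerSum⁻ L i)) j                ≡⟨ ⋆-distribˡ-+ e′ g (weightedPowerSum⁻ L) j ⟩
    (e′ ⋆ g) j + (e′ ⋆ weightedPowerSum⁻ L) j                    ≡⟨ cong₂ _+_ (trans (⋆-cong j (esym-∷ a L₁) (λ _ → refl)) ([1+aX]⋆geometric e a b j)) rest ⟩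
    b * e j + (∂esym (suc j) L + a * (shift e ⋆ weightedPowerSum⁻ L) j)
                                                                 ≡⟨ cong (λ z → b * e j + (∂esym (suc j) L + a * z)) (lower j) ⟩
    b * e j + (∂esym (suc j) L + a * ∂esym j L)                  ≡⟨ solve 3 (λ x y z → x :+ (y :+ z) := y :+ z :+ x) refl (b * e j) (∂esym (suc j) L) (a * ∂esym j L) ⟩
    ∂esym (suc j) L + a * ∂esym j L + b * e j                    ∎)
    where
    L₁ : List ℚ
    L₁ = map proj₁ L
    e e′ g : ℕ → ℚ
    e  i = esym i L₁
    e′ i = esym i (a ∷ L₁)
    g  i = b * (- a) ^ℚ i
    rest : (e′ ⋆ weightedPowerSum⁻ L) j ≡ ∂esym (suc j) L + a * (shift e ⋆ weightedPowerSum⁻ L) j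
    rest = begin
      (e′ ⋆ weightedPowerSum⁻ L) j                                          ≡⟨ ⋆-cong j (esym-∷ a L₁) (λ _ → refl) ⟩
      ((λ i → e i + a * shift e i) ⋆ weightedPowerSum⁻ L) j                 ≡⟨ ⋆-distribʳ-+ e (λ i → a * shift e i) (weightedPowerSum⁻ L) j ⟩
      (e ⋆ weightedPowerSum⁻ L) j + ((λ i → a * shift e i) ⋆ weightedPowerSum⁻ L) j
                                                                            ≡⟨ cong₂ _+_ (sym (∂esym-newton L j)) (⋆-*ˡ a (shift e) (weightedPowerSum⁻ L) j) ⟩
      ∂esym (suc j) L + a * (shift e ⋆ weightedPowerSum⁻ L) j               ∎
    lower : ∀ j → (shift e ⋆ weightedPowerSum⁻ L) j ≡ ∂esym j L
    lower zero    = shift-⋆-zero e (weightedPowerSum⁻ L)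
    lower (suc j) = trans (shift-⋆-suc e (weightedPowerSum⁻ L) j) (sym (∂esym-newton L j))

  ∂hsym-newton : ∀ L j → ∂hsym (suc j) L ≡ ((λ i → hsym i (map proj₁ L)) ⋆ weightedPowerSum L) j
  ∂hsym-newton []            j = sym (⋆-zeroʳ _ j)
  ∂hsym-newton ((a , b) ∷ L) j = trans (split j) (sym (⋆-distribˡ-+ h′ g (weightedPowerSum L) j))
    where
    L₁ : List ℚ
    L₁ = map proj₁ L
    h′ g : ℕ → ℚ
    h′ i = hsym i (a ∷ L₁)
    g  i = b * a ^ℚ i
    rest : ∀ j → (h′ ⋆ weightedPowerSum L) j ≡ ∂hsym (suc j) L + a * (shift h′ ⋆ weightedPowerSum L) j
    rest j = begin
      (h′ ⋆ weightedPowerSum L) j                                         ≡⟨ ⋆-cong j (hsym-∷ a L₁) (λ _ → refl) ⟩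
      ((λ i → hsym i L₁ + a * shift h′ i) ⋆ weightedPowerSum L) j         ≡⟨ ⋆-distribʳ-+ (λ i → hsym i L₁) (λ i → a * shift h′ i) (weightedPowerSum L) j ⟩
      ((λ i → hsym i L₁) ⋆ weightedPowerSum L) j + ((λ i → a * shift h′ i) ⋆ weightedPowerSum L) j
                                                                          ≡⟨ cong₂ _+_ (sym (∂hsym-newton L j)) (⋆-*ˡ a (shift h′) (weightedPowerSum L) j) ⟩
      ∂hsym (suc j) L + a * (shift h′ ⋆ weightedPowerSum L) j             ∎
    split : ∀ j → ∂hsym (suc j) ((a , b) ∷ L) ≡ (h′ ⋆ g) j + (h′ ⋆ weightedPowerSum L) j
    split zero = begin
      ∂hsym 1 L + a * 0ℚ + b * 1ℚ                                  ≡⟨ solve 3 (λ x a b → x :+ a :* con 0ℚ :+ b :* con 1ℚ := con 1ℚ :* (b :* con 1ℚ) :+ (x :+ a :* con 0ℚ))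
                                                                        refl (∂hsym 1 L) a b ⟩
      1ℚ * (b * 1ℚ) + (∂hsym 1 L + a * 0ℚ)                          ≡⟨ cong (λ z → 1ℚ * (b * 1ℚ) + (∂hsym 1 L + a * z)) (sym (shift-⋆-zero h′ (weightedPowerSum L))) ⟩
      (h′ ⋆ g) 0 + (∂hsym 1 L + a * (shift h′ ⋆ weightedPowerSum L) 0)
                                                                   ≡⟨ cong ((h′ ⋆ g) 0 +_) (sym (rest 0)) ⟩
      (h′ ⋆ g) 0 + (h′ ⋆ weightedPowerSum L) 0                      ∎
    split (suc j) = begin
      ∂hsym (2 ℕ.+ j) L + a * ∂hsym (suc j) ((a , b) ∷ L) + b * h′ (suc j)
                                                                   ≡⟨ cong (λ z → ∂hsym (2 ℕ.+ j) L + a * z + b * h′ (suc j)) (split j) ⟩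
      ∂hsym (2 ℕ.+ j) L + a * ((h′ ⋆ g) j + (h′ ⋆ weightedPowerSum L) j) + b * h′ (suc j)
                                                                   ≡⟨ solve 6 (λ x a u v w b → x :+ a :* (u :+ v) :+ b :* w := (w :* (b :* con 1ℚ) :+ a :* u) :+ (x :+ a :* v))
                                                                        refl (∂hsym (2 ℕ.+ j) L) a ((h′ ⋆ g) j) ((h′ ⋆ weightedPowerSum L) j) (h′ (suc j)) b ⟩
      (h′ (suc j) * (b * 1ℚ) + a * (h′ ⋆ g) j) + (∂hsym (2 ℕ.+ j) L + a * (h′ ⋆ weightedPowerSum L) j)
                                                                   ≡⟨ cong₂ _+_ (sym (⋆-geometric-suc h′ b a j))
                                                                        (cong (λ z → ∂hsym (2 ℕ.+ j) L + a * z) (sym (shift-⋆-suc h′ (weightedPowerSum L) j))) ⟩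
      (h′ ⋆ g) (suc j) + (∂hsym (2 ℕ.+ j) L + a * (shift h′ ⋆ weightedPowerSum L) (suc j))
                                                                   ≡⟨ cong ((h′ ⋆ g) (suc j) +_) (sym (rest (suc j))) ⟩
      (h′ ⋆ g) (suc j) + (h′ ⋆ weightedPowerSum L) (suc j)          ∎

  diag : List ℚ → List (ℚ × ℚ)
  diag = map (λ a → a , a)

  map-proj₁-diag : ∀ L → map proj₁ (diag L) ≡ L
  map-proj₁-diag L = trans (sym (List.map-∘ L)) (List.map-id L)

  ∂esym-diag : ∀ L j → ∂esym j (diag L) ≡ ι j * esym j L
  ∂esym-diag L       zero    = sym (ℚP.*-zeroˡ 1ℚ)
  ∂esym-diag []      (suc j) = sym (ℚP.*-zeroʳ (ι (suc j)))
  ∂esym-diag (a ∷ L) (suc j) = begin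
    ∂esym (suc j) (diag L) + a * ∂esym j (diag L) + a * esym j (map proj₁ (diag L))
                                                           ≡⟨ cong₂ (λ u v → u + a * ∂esym j (diag L) + a * esym j v) (∂esym-diag L (suc j)) (map-proj₁-diag L) ⟩
    ι (suc j) * esym (suc j) L + a * ∂esym j (diag L) + a * esym j L
                                                           ≡⟨ cong (λ z → ι (suc j) * esym (suc j) L + a * z + a * esym j L) (∂esym-diag L j) ⟩
    ι (suc j) * esym (suc j) L + a * (ι j * esym j L) + a * esym j L
                                                           ≡⟨ cong (λ z → z * esym (suc j) L + a * (ι j * esym j L) + a * esym j L) (ι-suc j) ⟩
    (1ℚ + ι j) * esym (suc j) L + a * (ι j * esym j L) + a * esym j L
                                                           ≡⟨ solve 4 (λ i x a y → (con 1ℚ :+ i) :* x :+ a :* (i :* y) :+ a :* y := (con 1ℚ :+ i) :* (x :+ a :* y))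
                                                                refl (ι j) (esym (suc j) L) a (esym j L) ⟩
    (1ℚ + ι j) * (esym (suc j) L + a * esym j L)           ≡⟨ cong (_* (esym (suc j) L + a * esym j L)) (ι-suc j) ⟨
    ι (suc j) * (esym (suc j) L + a * esym j L)            ∎

  ∂hsym-diag : ∀ L j → ∂hsym j (diag L) ≡ ι j * hsym j L
  ∂hsym-diag L       zero    = sym (ℚP.*-zeroˡ 1ℚ)
  ∂hsym-diag []      (suc j) = sym (ℚP.*-zeroʳ (ι (suc j)))
  ∂hsym-diag (a ∷ L) (suc j) = begin
    ∂hsym (suc j) (diag L) + a * ∂hsym j (diag (a ∷ L)) + a * hsym j (a ∷ map proj₁ (diag L))
                                                           ≡⟨ cong₂ (λ u v → u + a * ∂hsym j (diag (a ∷ L)) + a * hsym j (a ∷ v)) (∂hsym-diag L (suc j)) (map-proj₁-diag L) ⟩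
    ι (suc j) * hsym (suc j) L + a * ∂hsym j (diag (a ∷ L)) + a * hsym j (a ∷ L)
                                                           ≡⟨ cong (λ z → ι (suc j) * hsym (suc j) L + a * z + a * hsym j (a ∷ L)) (∂hsym-diag (a ∷ L) j) ⟩
    ι (suc j) * hsym (suc j) L + a * (ι j * hsym j (a ∷ L)) + a * hsym j (a ∷ L)
                                                           ≡⟨ cong (λ z → z * hsym (suc j) L + a * (ι j * hsym j (a ∷ L)) + a * hsym j (a ∷ L)) (ι-suc j) ⟩
    (1ℚ + ι j) * hsym (suc j) L + a * (ι j * hsym j (a ∷ L)) + a * hsym j (a ∷ L)
                                                           ≡⟨ solve 4 (λ i x a y → (con 1ℚ :+ i) :* x :+ a :* (i :* y) :+ a :* y := (con 1ℚ :+ i) :* (x :+ a :* y))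
                                                                refl (ι j) (hsym (suc j) L) a (hsym j (a ∷ L)) ⟩
    (1ℚ + ι j) * (hsym (suc j) L + a * hsym j (a ∷ L))     ≡⟨ cong (_* (hsym (suc j) L + a * hsym j (a ∷ L))) (ι-suc j) ⟨
    ι (suc j) * (hsym (suc j) L + a * hsym j (a ∷ L))      ∎

  newton-esym : ∀ L j → ι (suc j) * esym (suc j) L ≡ ((λ i → esym i L) ⋆ weightedPowerSum⁻ (diag L)) j
  newton-esym L j = trans (sym (∂esym-diag L (suc j)))
    (trans (∂esym-newton (diag L) j) (⋆-cong j (λ i → cong (esym i) (map-proj₁-diag L)) (λ _ → refl)))

  newton-hsym : ∀ L j → ι (suc j) * hsym (suc j) L ≡ ((λ i → hsym i L) ⋆ weightedPowerSum (diag L)) j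
  newton-hsym L j = trans (sym (∂hsym-diag L (suc j)))
    (trans (∂hsym-newton (diag L) j) (⋆-cong j (λ i → cong (hsym i) (map-proj₁-diag L)) (λ _ → refl)))

  private
    esym-∷-cong : ∀ x {L L′} → (∀ j → esym j L ≡ esym j L′) → ∀ j → esym j (x ∷ L) ≡ esym j (x ∷ L′)
    esym-∷-cong x eq zero    = refl
    esym-∷-cong x eq (suc j) = cong₂ (λ u v → u + x * v) (eq (suc j)) (eq j)

    esym-swap : ∀ x y L j → esym j (x ∷ y ∷ L) ≡ esym j (y ∷ x ∷ L)
    esym-swap x y L zero          = refl
    esym-swap x y L (suc zero)    = solve 3 (λ a x y → (a :+ y :* con 1ℚ) :+ x :* con 1ℚ := (a :+ x :* con 1ℚ) :+ y :* con 1ℚ) refl (esym 1 L) x y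
    esym-swap x y L (suc (suc j)) = solve 5 (λ a b c x y → (a :+ y :* b) :+ x :* (b :+ y :* c) := (a :+ x :* b) :+ y :* (b :+ x :* c))
                                      refl (esym (2 ℕ.+ j) L) (esym (suc j) L) (esym j L) x y

  esym-↭ : ∀ {L L′} → L ↭ L′ → ∀ j → esym j L ≡ esym j L′
  esym-↭ ↭.refl             j = refl
  esym-↭ (↭.prep x L↭)      j = esym-∷-cong x (esym-↭ L↭) j
  esym-↭ (↭.swap x y L↭)    j = trans (esym-∷-cong x (esym-∷-cong y (esym-↭ L↭)) j) (esym-swap x y _ j)
  esym-↭ (↭.trans L↭ L↭′)   j = trans (esym-↭ L↭ j) (esym-↭ L↭′ j)

  private
    hsym-∷-cong : ∀ x {L L′} → (∀ j → hsym j L ≡ hsym j L′) → ∀ j → hsym j (x ∷ L) ≡ hsym j (x ∷ L′)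
    hsym-∷-cong x eq zero    = refl
    hsym-∷-cong x eq (suc j) = cong₂ (λ u v → u + x * v) (eq (suc j)) (hsym-∷-cong x eq j)

    -- hsym j and hsym (suc j) must be swapped together: the recursion of hsym keeps the head.
    hsym-swap : ∀ x y L j → hsym j (x ∷ y ∷ L) ≡ hsym j (y ∷ x ∷ L) × hsym (suc j) (x ∷ y ∷ L) ≡ hsym (suc j) (y ∷ x ∷ L)
    hsym-swap x y L zero    = refl , solve 3 (λ a x y → (a :+ y :* con 1ℚ) :+ x :* con 1ℚ := (a :+ x :* con 1ℚ) :+ y :* con 1ℚ) refl (hsym 1 L) x y
    hsym-swap x y L (suc j) with hsym-swap x y L j
    ... | eq₀ , eq₁ = eq₁ , (begin
      (α + y * c) + x * (c + x * t)          ≡⟨ solve 5 (λ α c t x y → (α :+ y :* c) :+ x :* (c :+ x :* t) := α :+ (x :+ y) :* (c :+ x :* t) :- x :* y :* t)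
                                                  refl α c t x y ⟩
      α + (x + y) * (c + x * t) - x * y * t  ≡⟨ cong (λ z → α + (x + y) * z - x * y * t) (trans eq₁ (cong (λ z → d + y * z) (sym eq₀))) ⟩
      α + (x + y) * (d + y * t) - x * y * t  ≡⟨ solve 5 (λ α d t x y → α :+ (x :+ y) :* (d :+ y :* t) :- x :* y :* t := (α :+ x :* d) :+ y :* (d :+ y :* t))
                                                  refl α d t x y ⟩
      (α + x * d) + y * (d + y * t)          ≡⟨ cong (λ z → (α + x * d) + y * (d + y * z)) eq₀ ⟩
      (α + x * d) + y * (d + y * hsym j (y ∷ x ∷ L)) ∎)
      where
      t c d α : ℚ
      t = hsym j (x ∷ y ∷ L)
      c = hsym (suc j) (y ∷ L)
      d = hsym (suc j) (x ∷ L)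
      α = hsym (2 ℕ.+ j) L

  hsym-↭ : ∀ {L L′} → L ↭ L′ → ∀ j → hsym j L ≡ hsym j L′
  hsym-↭ ↭.refl             j = refl
  hsym-↭ (↭.prep x L↭)      j = hsym-∷-cong x (hsym-↭ L↭) j
  hsym-↭ (↭.swap x y L↭)    j = trans (hsym-∷-cong x (hsym-∷-cong y (hsym-↭ L↭)) j) (proj₁ (hsym-swap x y _ j))
  hsym-↭ (↭.trans L↭ L↭′)   j = trans (hsym-↭ L↭ j) (hsym-↭ L↭′ j)

  esym-map-* : ∀ c L j → esym j (map (c *_) L) ≡ c ^ℚ j * esym j L
  esym-map-* c L       zero    = refl
  esym-map-* c []      (suc j) = sym (ℚP.*-zeroʳ (c ^ℚ suc j))
  esym-map-* c (a ∷ L) (suc j) = trans (cong₂ (λ u v → u + c * a * v) (esym-map-* c L (suc j)) (esym-map-* c L j))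
    (solve 5 (λ c w x a y → c :* w :* x :+ c :* a :* (w :* y) := c :* w :* (x :+ a :* y)) refl c (c ^ℚ j) (esym (suc j) L) a (esym j L))

  hsym-map-* : ∀ c L j → hsym j (map (c *_) L) ≡ c ^ℚ j * hsym j L
  hsym-map-* c L       zero    = refl
  hsym-map-* c []      (suc j) = sym (ℚP.*-zeroʳ (c ^ℚ suc j))
  hsym-map-* c (a ∷ L) (suc j) = trans (cong₂ (λ u v → u + c * a * v) (hsym-map-* c L (suc j)) (hsym-map-* c (a ∷ L) j))
    (solve 5 (λ c w x a y → c :* w :* x :+ c :* a :* (w :* y) := c :* w :* (x :+ a :* y)) refl c (c ^ℚ j) (hsym (suc j) L) a (hsym j (a ∷ L)))

  module _ {A : Set} where

    applyDownFrom-cong : ∀ {f g : ℕ → A} n → (∀ {m} → m < n → f m ≡ g m) → applyDownFrom f n ≡ applyDownFrom g n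
    applyDownFrom-cong zero    f≡g = refl
    applyDownFrom-cong (suc n) f≡g = cong₂ _∷_ (f≡g ℕP.≤-refl) (applyDownFrom-cong n (λ m<n → f≡g (ℕP.m<n⇒m<1+n m<n)))

    applyDownFrom-reflect : ∀ (f : ℕ → A) n → applyDownFrom (λ m → f (n ∸ suc m)) n ≡ applyUpTo f n
    applyDownFrom-reflect f zero    = refl
    applyDownFrom-reflect f (suc n) = cong₂ _∷_ (cong f (ℕP.n∸n≡0 n))
      (trans (applyDownFrom-cong n (λ m<n → cong f (ℕP.+-∸-assoc 1 m<n))) (applyDownFrom-reflect (λ m → f (suc m)) n))

    All-applyDownFrom : ∀ {P : A → Set} {f : ℕ → A} n → (∀ {m} → m < n → P (f m)) → All P (applyDownFrom f n)
    All-applyDownFrom zero    Pf = []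
    All-applyDownFrom (suc n) Pf = Pf ℕP.≤-refl ∷ All-applyDownFrom n (λ m<n → Pf (ℕP.m<n⇒m<1+n m<n))

    Pointwise-applyDownFrom : ∀ {B : Set} {R : A → B → Set} {f : ℕ → A} {g : ℕ → B} n →
      (∀ {m} → m < n → R (f m) (g m)) → Pointwise R (applyDownFrom f n) (applyDownFrom g n)
    Pointwise-applyDownFrom zero    Rfg = []
    Pointwise-applyDownFrom (suc n) Rfg = Rfg ℕP.≤-refl ∷ Pointwise-applyDownFrom n (λ m<n → Rfg (ℕP.m<n⇒m<1+n m<n))

  weightedPowerSum-applyDownFrom : ∀ (u v : ℕ → ℚ) n i → weightedPowerSum (applyDownFrom (λ k → u k , v k) n) i ≡ sum< (λ k → v k * u k ^ℚ i) n
  weightedPowerSum-applyDownFrom u v zero    i = refl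
  weightedPowerSum-applyDownFrom u v (suc n) i = trans (cong (v n * u n ^ℚ i +_) (weightedPowerSum-applyDownFrom u v n i)) (ℚP.+-comm (v n * u n ^ℚ i) _)

  weightedPowerSum⁻-applyDownFrom : ∀ (u v : ℕ → ℚ) n i → weightedPowerSum⁻ (applyDownFrom (λ k → u k , v k) n) i ≡ sum< (λ k → v k * (- u k) ^ℚ i) n
  weightedPowerSum⁻-applyDownFrom u v zero    i = refl
  weightedPowerSum⁻-applyDownFrom u v (suc n) i = trans (cong (v n * (- u n) ^ℚ i +_) (weightedPowerSum⁻-applyDownFrom u v n i)) (ℚP.+-comm (v n * (- u n) ^ℚ i) _)

module PAdic (p : ℕ) (p-prime : Prime p) where

  open Arithmetic
  open import Data.Integer as ℤ using (ℤ; +_)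
  import Data.Integer.Properties as ℤP
  open import Data.Rational as ℚ using (ℚ; 0ℚ; 1ℚ; _+_; _*_; _-_; -_; _/_)
  import Data.Rational.Properties as ℚP
  open import Data.Rational.Solver using (module +-*-Solver)
  open +-*-Solver
  open import Data.Nat.Divisibility using (_∣_; divides; ∣-refl; ∣-trans; ∣1⇒≡1; ∣⇒≤)
  open import Data.Nat.Coprimality using (Coprime; coprime-divisor)
  open import Data.Nat.GCD using (gcd; gcd[m,n]∣n)
  open import Data.Nat.Primality using (euclidsLemma; prime⇒irreducible; prime⇒nonTrivial)
  open import Defs using (_≡0mod_; invPow)
  open ≡-Reasoning

  p∤-* : ∀ {m n} → ¬ p ∣ m → ¬ p ∣ n → ¬ p ∣ (m ℕ.* n)
  p∤-* {m} {n} p∤m p∤n p∣mn with euclidsLemma m n p-prime p∣mn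
  ... | inj₁ p∣m = p∤m p∣m
  ... | inj₂ p∣n = p∤n p∣n

  p∤1 : ¬ p ∣ 1
  p∤1 p∣1 = ℕ.nonTrivial⇒≢1 {{prime⇒nonTrivial p-prime}} (∣1⇒≡1 p∣1)

  p∤-^ : ∀ {k} s → ¬ p ∣ k → ¬ p ∣ (k ℕ.^ s)
  p∤-^ zero    p∤k = p∤1
  p∤-^ (suc s) p∤k = p∤-* p∤k (p∤-^ s p∤k)

  <p⇒p∤ : ∀ {k} → 0 < k → k < p → ¬ p ∣ k
  <p⇒p∤ {suc k} _ k<p p∣k = ℕP.<⇒≱ k<p (∣⇒≤ p∣k)

  infix 4 p^_∣_ _≡_[p^_]

  -- p^e divides q in the ring of p-integral rationals: q · den = p^e · (num⁺ − num⁻) with p ∤ den.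
  record p^_∣_ (e : ℕ) (q : ℚ) : Set where
    constructor mk∣
    field
      den num⁺ num⁻ : ℕ
      p∤den : ¬ p ∣ den
      q*den≡ : q * ι den ≡ ι (p ℕ.^ e) * (ι num⁺ - ι num⁻)

  Integral : ℚ → Set
  Integral q = p^ 0 ∣ q

  ∣-+ : ∀ {e q r} → p^ e ∣ q → p^ e ∣ r → p^ e ∣ (q + r)
  ∣-+ {e} {q} {r} (mk∣ d₁ a₁ b₁ p∤d₁ eq₁) (mk∣ d₂ a₂ b₂ p∤d₂ eq₂) =
    mk∣ (d₁ ℕ.* d₂) (a₁ ℕ.* d₂ ℕ.+ a₂ ℕ.* d₁) (b₁ ℕ.* d₂ ℕ.+ b₂ ℕ.* d₁) (p∤-* p∤d₁ p∤d₂) (begin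
      (q + r) * ι (d₁ ℕ.* d₂)                              ≡⟨ cong ((q + r) *_) (ι-* d₁ d₂) ⟩
      (q + r) * (ι d₁ * ι d₂)                              ≡⟨ solve 4 (λ q r x y → (q :+ r) :* (x :* y) := (q :* x) :* y :+ (r :* y) :* x) refl q r (ι d₁) (ι d₂) ⟩
      (q * ι d₁) * ι d₂ + (r * ι d₂) * ι d₁                ≡⟨ cong₂ (λ u v → u * ι d₂ + v * ι d₁) eq₁ eq₂ ⟩
      P * (ι a₁ - ι b₁) * ι d₂ + P * (ι a₂ - ι b₂) * ι d₁  ≡⟨ solve 7 (λ P a₁ b₁ a₂ b₂ x y → P :* (a₁ :- b₁) :* y :+ P :* (a₂ :- b₂) :* x
                                                                := P :* ((a₁ :* y :+ a₂ :* x) :- (b₁ :* y :+ b₂ :* x)))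
                                                                refl P (ι a₁) (ι b₁) (ι a₂) (ι b₂) (ι d₁) (ι d₂) ⟩
      P * ((ι a₁ * ι d₂ + ι a₂ * ι d₁) - (ι b₁ * ι d₂ + ι b₂ * ι d₁))
                                                           ≡⟨ cong₂ (λ u v → P * (u - v)) (sym (ι-+-* a₁ d₂ a₂ d₁)) (sym (ι-+-* b₁ d₂ b₂ d₁)) ⟩
      P * (ι (a₁ ℕ.* d₂ ℕ.+ a₂ ℕ.* d₁) - ι (b₁ ℕ.* d₂ ℕ.+ b₂ ℕ.* d₁)) ∎)
    where
    P : ℚ
    P = ι (p ℕ.^ e)
    ι-+-* : ∀ a b c d → ι (a ℕ.* b ℕ.+ c ℕ.* d) ≡ ι a * ι b + ι c * ι d
    ι-+-* a b c d = trans (ι-+ (a ℕ.* b) (c ℕ.* d)) (cong₂ _+_ (ι-* a b) (ι-* c d))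

  ∣-neg : ∀ {e q} → p^ e ∣ q → p^ e ∣ (- q)
  ∣-neg {e} {q} (mk∣ d a b p∤d eq) = mk∣ d b a p∤d (begin
    - q * ι d                     ≡⟨ ℚP.neg-distribˡ-* q (ι d) ⟨
    - (q * ι d)                   ≡⟨ cong -_ eq ⟩
    - (P * (ι a - ι b))           ≡⟨ solve 3 (λ P a b → :- (P :* (a :- b)) := P :* (b :- a)) refl P (ι a) (ι b) ⟩
    P * (ι b - ι a)               ∎)
    where
    P : ℚ
    P = ι (p ℕ.^ e)

  ∣-- : ∀ {e q r} → p^ e ∣ q → p^ e ∣ r → p^ e ∣ (q - r)
  ∣-- q∣ r∣ = ∣-+ q∣ (∣-neg r∣)

  ∣-* : ∀ {e f q r} → p^ e ∣ q → p^ f ∣ r → p^ (e ℕ.+ f) ∣ (q * r)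
  ∣-* {e} {f} {q} {r} (mk∣ d₁ a₁ b₁ p∤d₁ eq₁) (mk∣ d₂ a₂ b₂ p∤d₂ eq₂) =
    mk∣ (d₁ ℕ.* d₂) (a₁ ℕ.* a₂ ℕ.+ b₁ ℕ.* b₂) (a₁ ℕ.* b₂ ℕ.+ b₁ ℕ.* a₂) (p∤-* p∤d₁ p∤d₂) (begin
      (q * r) * ι (d₁ ℕ.* d₂)                              ≡⟨ cong ((q * r) *_) (ι-* d₁ d₂) ⟩
      (q * r) * (ι d₁ * ι d₂)                              ≡⟨ solve 4 (λ q r x y → (q :* r) :* (x :* y) := (q :* x) :* (r :* y)) refl q r (ι d₁) (ι d₂) ⟩
      (q * ι d₁) * (r * ι d₂)                              ≡⟨ cong₂ _*_ eq₁ eq₂ ⟩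
      P * (ι a₁ - ι b₁) * (Q * (ι a₂ - ι b₂))              ≡⟨ solve 6 (λ P Q a₁ b₁ a₂ b₂ → P :* (a₁ :- b₁) :* (Q :* (a₂ :- b₂))
                                                                := (P :* Q) :* ((a₁ :* a₂ :+ b₁ :* b₂) :- (a₁ :* b₂ :+ b₁ :* a₂)))
                                                                refl P Q (ι a₁) (ι b₁) (ι a₂) (ι b₂) ⟩
      (P * Q) * ((ι a₁ * ι a₂ + ι b₁ * ι b₂) - (ι a₁ * ι b₂ + ι b₁ * ι a₂))
                                                           ≡⟨ cong₂ _*_ (sym P*Q) (cong₂ _-_ (sym (ι-+-* a₁ a₂ b₁ b₂)) (sym (ι-+-* a₁ b₂ b₁ a₂))) ⟩
      ι (p ℕ.^ (e ℕ.+ f)) * (ι (a₁ ℕ.* a₂ ℕ.+ b₁ ℕ.* b₂) - ι (a₁ ℕ.* b₂ ℕ.+ b₁ ℕ.* a₂)) ∎)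
    where
    P Q : ℚ
    P = ι (p ℕ.^ e)
    Q = ι (p ℕ.^ f)
    P*Q : ι (p ℕ.^ (e ℕ.+ f)) ≡ P * Q
    P*Q = trans (cong ι (ℕP.^-distribˡ-+-* p e f)) (ι-* (p ℕ.^ e) (p ℕ.^ f))
    ι-+-* : ∀ a b c d → ι (a ℕ.* b ℕ.+ c ℕ.* d) ≡ ι a * ι b + ι c * ι d
    ι-+-* a b c d = trans (ι-+ (a ℕ.* b) (c ℕ.* d)) (cong₂ _+_ (ι-* a b) (ι-* c d))

  ∣-*ʳ : ∀ {e q r} → p^ e ∣ q → Integral r → p^ e ∣ (q * r)
  ∣-*ʳ {e} q∣ r∣ = subst (p^_∣ _) (ℕP.+-identityʳ e) (∣-* q∣ r∣)

  ∣-pred : ∀ {e q} → p^ suc e ∣ q → p^ e ∣ q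
  ∣-pred {e} {q} (mk∣ d a b p∤d eq) = mk∣ d (p ℕ.* a) (p ℕ.* b) p∤d (begin
    q * ι d                                   ≡⟨ eq ⟩
    ι (p ℕ.* p ℕ.^ e) * (ι a - ι b)           ≡⟨ cong (_* (ι a - ι b)) (ι-* p (p ℕ.^ e)) ⟩
    ι p * ι (p ℕ.^ e) * (ι a - ι b)           ≡⟨ solve 4 (λ x P a b → x :* P :* (a :- b) := P :* (x :* a :- x :* b)) refl (ι p) (ι (p ℕ.^ e)) (ι a) (ι b) ⟩
    ι (p ℕ.^ e) * (ι p * ι a - ι p * ι b)     ≡⟨ cong₂ (λ u v → ι (p ℕ.^ e) * (u - v)) (sym (ι-* p a)) (sym (ι-* p b)) ⟩
    ι (p ℕ.^ e) * (ι (p ℕ.* a) - ι (p ℕ.* b)) ∎)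

  ∣⇒integral : ∀ {e q} → p^ e ∣ q → Integral q
  ∣⇒integral {zero}  q∣ = q∣
  ∣⇒integral {suc e} q∣ = ∣⇒integral (∣-pred q∣)

  ∣⇒∣ι : ∀ {e n} → p ℕ.^ e ∣ n → p^ e ∣ ι n
  ∣⇒∣ι {e} (divides c refl) = mk∣ 1 c 0 p∤1 (begin
    ι (c ℕ.* p ℕ.^ e) * 1ℚ      ≡⟨ cong (_* 1ℚ) (ι-* c (p ℕ.^ e)) ⟩
    ι c * ι (p ℕ.^ e) * 1ℚ      ≡⟨ solve 2 (λ c P → c :* P :* con 1ℚ := P :* (c :- con 0ℚ)) refl (ι c) (ι (p ℕ.^ e)) ⟩
    ι (p ℕ.^ e) * (ι c - ι 0)   ∎)

  integral-ι : ∀ n → Integral (ι n)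
  integral-ι n = ∣⇒∣ι (divides n (sym (ℕP.*-identityʳ n)))

  ∣-0 : ∀ e → p^ e ∣ 0ℚ
  ∣-0 e = ∣⇒∣ι {n = 0} (divides 0 refl)

  p∣⇒∣ι : ∀ {m} → p ∣ m → p^ 1 ∣ ι m
  p∣⇒∣ι (divides c refl) = ∣⇒∣ι (divides c (cong (c ℕ.*_) (sym (ℕP.*-identityʳ p))))

  ∣-p : p^ 1 ∣ ι p
  ∣-p = p∣⇒∣ι ∣-refl

  ∣-cancelˡ-ι : ∀ {e q} j → ¬ p ∣ j → p^ e ∣ (ι j * q) → p^ e ∣ q
  ∣-cancelˡ-ι {e} {q} j p∤j (mk∣ d a b p∤d eq) = mk∣ (j ℕ.* d) a b (p∤-* p∤j p∤d) (begin
    q * ι (j ℕ.* d)      ≡⟨ cong (q *_) (ι-* j d) ⟩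
    q * (ι j * ι d)      ≡⟨ solve 3 (λ q x y → q :* (x :* y) := (x :* q) :* y) refl q (ι j) (ι d) ⟩
    (ι j * q) * ι d      ≡⟨ eq ⟩
    ι (p ℕ.^ e) * (ι a - ι b) ∎)

  ∣-sum< : ∀ {e} f n → (∀ {j} → j < n → p^ e ∣ f j) → p^ e ∣ sum< f n
  ∣-sum< {e} f zero    f∣ = ∣-0 e
  ∣-sum< f (suc n) f∣ = ∣-+ (∣-sum< f n (λ j<n → f∣ (ℕP.m<n⇒m<1+n j<n))) (f∣ ℕP.≤-refl)

  integral-^ℚ : ∀ {a} k → Integral a → Integral (a ^ℚ k)
  integral-^ℚ zero    a∣ = integral-ι 1
  integral-^ℚ (suc k) a∣ = ∣-* a∣ (integral-^ℚ k a∣)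

  integral-invPow : ∀ m s → ¬ p ∣ suc m → Integral (invPow m s)
  integral-invPow m s p∤ = mk∣ (suc m ℕ.^ s) 1 0 (p∤-^ s p∤) (invPow-*-ι^ m s)

  coprime-p^ : ∀ e {m} → ¬ p ∣ m → Coprime (p ℕ.^ e) m
  coprime-p^ zero    p∤m (d∣1 , _)              = ∣1⇒≡1 d∣1
  coprime-p^ (suc e) p∤m {d} (d∣p*p^e , d∣m) = coprime-p^ e p∤m (coprime-divisor d⊥p d∣p*p^e , d∣m)
    where
    d⊥p : Coprime d p
    d⊥p {c} (c∣d , c∣p) with prime⇒irreducible p-prime c∣p
    ... | inj₁ c≡1 = c≡1
    ... | inj₂ refl = ⊥-elim (p∤m (∣-trans c∣d d∣m))

  -- Writing q = i / den, the reduced fraction is (i / g) / (den / g) with g = gcd |i| den; as p ∤ g, p^e still divides i / g.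
  p^∣⇒≡0mod : ∀ {e q} → p^ e ∣ q → q ≡0mod (p ℕ.^ e)
  p^∣⇒≡0mod     (mk∣ zero      a b p∤d eq) = ⊥-elim (p∤d (divides 0 refl))
  p^∣⇒≡0mod {e} {q} (mk∣ (suc d) a b p∤d eq) = coprime-p^ e p∤↧q , P∣↥q
    where
    P : ℕ
    P = p ℕ.^ e
    i : ℤ
    i = + P ℤ.* (+ a ℤ.- + b)
    q≡i/d : q ≡ i / suc d
    q≡i/d = *-cancelʳ-ι d (begin
      q * ι (suc d)                ≡⟨ eq ⟩
      ι P * (ι a - ι b)            ≡⟨ cong (ι P *_) (trans (ιℤ-+ (+ a) (ℤ.- + b)) (cong (λ z → ι a + z) (ιℤ-neg (+ b)))) ⟨
      ι P * ιℤ (+ a ℤ.- + b)       ≡⟨ ιℤ-* (+ P) (+ a ℤ.- + b) ⟨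
      ιℤ i                         ≡⟨ /-*-ι i d ⟨
      (i / suc d) * ι (suc d)      ∎)
    g : ℕ
    g = gcd ℤ.∣ i ∣ (suc d)
    p∤g : ¬ p ∣ g
    p∤g p∣g = p∤d (∣-trans p∣g (gcd[m,n]∣n ℤ.∣ i ∣ (suc d)))
    ↧q*g≡d : ℚ.↧ₙ q ℕ.* g ≡ suc d
    ↧q*g≡d = ℤP.+-injective (trans (ℤP.pos-* (ℚ.↧ₙ q) g) (trans (cong (λ z → ℚ.↧ z ℤ.* + g) q≡i/d) (ℚP.↧-/ i (suc d))))
    p∤↧q : ¬ p ∣ ℚ.↧ₙ q
    p∤↧q p∣↧q = p∤d (∣-trans p∣↧q (divides g (trans (sym ↧q*g≡d) (ℕP.*-comm (ℚ.↧ₙ q) g))))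
    ↥q*g≡ : ℤ.∣ ℚ.↥ q ∣ ℕ.* g ≡ P ℕ.* ℤ.∣ + a ℤ.- + b ∣
    ↥q*g≡ = begin
      ℤ.∣ ℚ.↥ q ∣ ℕ.* g                 ≡⟨ ℤP.abs-* (ℚ.↥ q) (+ g) ⟨
      ℤ.∣ ℚ.↥ q ℤ.* + g ∣               ≡⟨ cong (λ z → ℤ.∣ ℚ.↥ z ℤ.* + g ∣) q≡i/d ⟩
      ℤ.∣ ℚ.↥ (i / suc d) ℤ.* + g ∣     ≡⟨ cong ℤ.∣_∣ (ℚP.↥-/ i (suc d)) ⟩
      ℤ.∣ i ∣                           ≡⟨ ℤP.abs-* (+ P) (+ a ℤ.- + b) ⟩
      P ℕ.* ℤ.∣ + a ℤ.- + b ∣           ∎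
    P∣↥q : P ∣ ℤ.∣ ℚ.↥ q ∣
    P∣↥q = coprime-divisor (coprime-p^ e p∤g) (divides ℤ.∣ + a ℤ.- + b ∣ (trans (trans (ℕP.*-comm g _) ↥q*g≡) (ℕP.*-comm P _)))

  record _≡_[p^_] (a b : ℚ) (e : ℕ) : Set where
    constructor mod
    field p^e∣a-b : p^ e ∣ (a - b)
  open _≡_[p^_] public

  mod-refl : ∀ {e} a → a ≡ a [p^ e ]
  mod-refl {e} a = mod (subst (p^ e ∣_) (sym (ℚP.+-inverseʳ a)) (∣-0 e))

  ≡⇒mod : ∀ {e a b} → a ≡ b → a ≡ b [p^ e ]
  ≡⇒mod {a = a} refl = mod-refl a

  mod-trans : ∀ {e a b c} → a ≡ b [p^ e ] → b ≡ c [p^ e ] → a ≡ c [p^ e ]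
  mod-trans {e} {a} {b} {c} (mod a-b) (mod b-c) = mod (subst (p^ e ∣_) (solve 3 (λ a b c → (a :- b) :+ (b :- c) := a :- c) refl a b c) (∣-+ a-b b-c))

  mod-+ : ∀ {e a b c d} → a ≡ b [p^ e ] → c ≡ d [p^ e ] → a + c ≡ b + d [p^ e ]
  mod-+ {e} {a} {b} {c} {d} (mod a-b) (mod c-d) =
    mod (subst (p^ e ∣_) (solve 4 (λ a b c d → (a :- b) :+ (c :- d) := (a :+ c) :- (b :+ d)) refl a b c d) (∣-+ a-b c-d))

  mod-* : ∀ {e a b c d} → Integral a → Integral d → a ≡ b [p^ e ] → c ≡ d [p^ e ] → a * c ≡ b * d [p^ e ]
  mod-* {e} {a} {b} {c} {d} a∣ d∣ (mod a-b) (mod c-d) =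
    mod (subst (p^ e ∣_) (solve 4 (λ a b c d → a :* (c :- d) :+ (a :- b) :* d := a :* c :- b :* d) refl a b c d) (∣-+ (∣-* a∣ c-d) (∣-*ʳ a-b d∣)))

  mod-^ℚ : ∀ {e a b} k → Integral a → Integral b → a ≡ b [p^ e ] → a ^ℚ k ≡ b ^ℚ k [p^ e ]
  mod-^ℚ zero    a∣ b∣ a≡b = mod-refl 1ℚ
  mod-^ℚ (suc k) a∣ b∣ a≡b = mod-* a∣ (integral-^ℚ k b∣) a≡b (mod-^ℚ k a∣ b∣ a≡b)

  mod-∣ : ∀ {e a b} → a ≡ b [p^ e ] → p^ e ∣ b → p^ e ∣ a
  mod-∣ {e} {a} {b} (mod a-b) b∣ = subst (p^ e ∣_) (solve 2 (λ a b → (a :- b) :+ b := a) refl a b) (∣-+ a-b b∣)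

  mod-integral : ∀ {e a b} → a ≡ b [p^ e ] → Integral b → Integral a
  mod-integral (mod a-b) b∣ = mod-∣ (mod (∣⇒integral a-b)) b∣

  mod-inverse : ∀ {e x y z} → Integral y → y * x ≡ 1ℚ → x * z ≡ 1ℚ [p^ e ] → y ≡ z [p^ e ]
  mod-inverse {e} {x} {y} {z} y∣ yx≡1 (mod xz-1) = mod (subst (p^ e ∣_) eq (∣-neg (∣-* y∣ xz-1)))
    where
    eq : - (y * (x * z - 1ℚ)) ≡ y - z
    eq = begin
      - (y * (x * z - 1ℚ))             ≡⟨ solve 3 (λ y x z → :- (y :* (x :* z :- con 1ℚ)) := (y :- z) :- (y :* x :- con 1ℚ) :* z) refl y x z ⟩
      (y - z) - (y * x - 1ℚ) * z       ≡⟨ cong (λ w → (y - z) - (w - 1ℚ) * z) yx≡1 ⟩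
      (y - z) - (1ℚ - 1ℚ) * z          ≡⟨ solve 2 (λ a z → a :- (con 1ℚ :- con 1ℚ) :* z := a) refl (y - z) z ⟩
      y - z                            ∎

  ≡-neg+p*⇒∣ : ∀ {X Y} → ¬ p ∣ 2 → X ≡ - X + ι p * Y [p^ 2 ] → p^ 1 ∣ Y → p^ 2 ∣ X
  ≡-neg+p*⇒∣ {X} {Y} p∤2 (mod X≡) Y∣ = ∣-cancelˡ-ι 2 p∤2 (subst (p^ 2 ∣_) eq (∣-+ X≡ (∣-* ∣-p Y∣)))
    where
    eq : (X - (- X + ι p * Y)) + ι p * Y ≡ ι 2 * X
    eq = trans (solve 3 (λ X Y P → (X :- (:- X :+ P :* Y)) :+ P :* Y := (con 1ℚ :+ con 1ℚ) :* X) refl X Y (ι p)) (cong (_* X) (sym (ι-suc 1)))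

  mod-sum< : ∀ {e} f g n → (∀ {j} → j < n → f j ≡ g j [p^ e ]) → sum< f n ≡ sum< g n [p^ e ]
  mod-sum< f g zero    f≡g = mod-refl 0ℚ
  mod-sum< f g (suc n) f≡g = mod-+ (mod-sum< f g n (λ j<n → f≡g (ℕP.m<n⇒m<1+n j<n))) (f≡g ℕP.≤-refl)

module PowerSums (n′ : ℕ) (p-prime : Prime (2 ℕ.+ n′)) where

  n p : ℕ
  n = suc n′
  p = suc n

  open Arithmetic
  open PAdic p p-prime public
  open import Data.Rational as ℚ using (ℚ; 0ℚ; 1ℚ; _+_; _*_; _-_; -_)
  import Data.Rational.Properties as ℚP
  open import Data.Rational.Solver using (module +-*-Solver)
  open +-*-Solver
  open import Data.Nat.Combinatorics using (_C_; nCn≡1; nC1≡n; nCk≡nC[n∸k])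
  open import Data.Nat.Divisibility using (_∣_; divides; ∣⇒≤; ∣m+n∣m⇒∣n)
  open import Data.Nat.DivMod using (_%_; _/_; m≡m%n+[m/n]*n; m%n<n)
  open import Data.Nat.Primality using (euclidsLemma)
  open import Data.Nat.Induction using (<-rec)
  open ≡-Reasoning

  p∣pC[1+k] : ∀ {k} → k < n → p ∣ p C suc k
  p∣pC[1+k] {k} k<n with euclidsLemma (suc k) (p C suc k) p-prime (divides (n C k) (trans ([1+k]*[1+n]C[1+k] n k) (ℕP.*-comm p (n C k))))
  ... | inj₁ p∣1+k = ⊥-elim (ℕP.<⇒≱ (s≤s k<n) (∣⇒≤ p∣1+k))
  ... | inj₂ p∣C   = p∣C

  -- Freshman's dream (a + 1)^p ≡ a^p + 1, iterated from a = 0.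
  ∣-fermat : ∀ a → p^ 1 ∣ (ι a ^ℚ p - ι a)
  ∣-fermat zero    = subst (p^ 1 ∣_) (sym (solve 1 (λ w → con 0ℚ :* w :- con 0ℚ := con 0ℚ) refl (0ℚ ^ℚ n))) (∣-0 1)
  ∣-fermat (suc a) = subst (p^ 1 ∣_) eq (∣-+ (∣-fermat a) middle∣)
    where
    x : ℚ
    x = ι a
    t : ℕ → ℚ
    t j = ι (p C j) * x ^ℚ j
    middle∣ : p^ 1 ∣ sum< (λ j → t (suc j)) n
    middle∣ = ∣-sum< (λ j → t (suc j)) n (λ {j} j<n → ∣-*ʳ (p∣⇒∣ι (p∣pC[1+k] j<n)) (integral-^ℚ (suc j) (integral-ι a)))
    x+1≡ : x + 1ℚ ≡ ι (suc a)
    x+1≡ = trans (ℚP.+-comm x 1ℚ) (sym (ι-suc a))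
    eq : (x ^ℚ p - x) + sum< (λ j → t (suc j)) n ≡ ι (suc a) ^ℚ p - ι (suc a)
    eq = begin
      (x ^ℚ p - x) + sum< (λ j → t (suc j)) n                 ≡⟨ solve 3 (λ P x m → (P :- x) :+ m := (con 1ℚ :+ m :+ con 1ℚ :* P) :- (x :+ con 1ℚ))
                                                                    refl (x ^ℚ p) x (sum< (λ j → t (suc j)) n) ⟩
      (1ℚ + sum< (λ j → t (suc j)) n + 1ℚ * x ^ℚ p) - (x + 1ℚ) ≡⟨ cong₂ (λ u v → u + 1ℚ * x ^ℚ p - v) (sym (sum<-suc t n)) x+1≡ ⟩
      (sum< t p + 1ℚ * x ^ℚ p) - ι (suc a)                    ≡⟨ cong (λ c → sum< t p + ι c * x ^ℚ p - ι (suc a)) (sym (nCn≡1 p)) ⟩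
      sum< t (suc p) - ι (suc a)                              ≡⟨ cong (_- ι (suc a)) (sym (binomial x p)) ⟩
      (x + 1ℚ) ^ℚ p - ι (suc a)                               ≡⟨ cong (λ z → z ^ℚ p - ι (suc a)) x+1≡ ⟩
      ι (suc a) ^ℚ p - ι (suc a)                              ∎

  fermat : ∀ {a} → ¬ p ∣ a → ι a ^ℚ n ≡ 1ℚ [p^ 1 ]
  fermat {a} p∤a = mod (∣-cancelˡ-ι a p∤a (subst (p^ 1 ∣_) (solve 2 (λ x w → x :* w :- x := x :* (w :- con 1ℚ)) refl (ι a) (ι a ^ℚ n)) (∣-fermat a)))

  residuePowerSum : ℕ → ℚ
  residuePowerSum r = sum< (λ k → ι k ^ℚ r) p

  private
    S : ℕ → ℚ
    S = residuePowerSum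

    binomial-residuePowerSum : ∀ r → sum< (λ j → ι (suc r C j) * S j) (2 ℕ.+ r) ≡ S (suc r) + ι p ^ℚ suc r
    binomial-residuePowerSum r = begin
      sum< (λ j → ι (m C j) * S j) (suc m)                      ≡⟨ sum<-cong (suc m) (λ {j} _ → sym (sum<-*ˡ (ι (m C j)) (λ k → ι k ^ℚ j) p)) ⟩
      sum< (λ j → sum< (λ k → ι (m C j) * ι k ^ℚ j) p) (suc m)  ≡⟨ sum<-comm (λ k j → ι (m C j) * ι k ^ℚ j) p (suc m) ⟨
      sum< (λ k → sum< (λ j → ι (m C j) * ι k ^ℚ j) (suc m)) p  ≡⟨ sum<-cong p (λ {k} _ → trans (sym (binomial (ι k) m)) (cong (_^ℚ m) (trans (ℚP.+-comm (ι k) 1ℚ) (sym (ι-suc k))))) ⟩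
      sum< (λ k → ι (suc k) ^ℚ m) p                             ≡⟨ ℚP.+-identityʳ _ ⟨
      sum< (λ k → ι (suc k) ^ℚ m) p + 0ℚ                        ≡⟨ cong (sum< (λ k → ι (suc k) ^ℚ m) p +_) (sym (ℚP.*-zeroˡ (0ℚ ^ℚ r))) ⟩
      sum< (λ k → ι (suc k) ^ℚ m) p + ι 0 ^ℚ m                  ≡⟨ sum<-telescope (λ k → ι k ^ℚ m) p ⟩
      S m + ι p ^ℚ m                                            ∎
      where
      m : ℕ
      m = suc r

  -- Σ_{j ≤ r} C(r+1, j) S_j = p^{r+1}, with the top term split off.
  residuePowerSum-recurrence : ∀ r → ι (suc r) * S r + sum< (λ j → ι (suc r C j) * S j) r ≡ ι p ^ℚ suc r
  residuePowerSum-recurrence r = begin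
    ι (suc r) * S r + sum< t r                                 ≡⟨ solve 3 (λ a b c → a :+ b := ((b :+ a) :+ c) :- c) refl (ι (suc r) * S r) (sum< t r) (S (suc r)) ⟩
    ((sum< t r + ι (suc r) * S r) + S (suc r)) - S (suc r)     ≡⟨ cong₂ (λ u v → ((sum< t r + ι u * S r) + v) - S (suc r)) (sym [1+r]Cr≡1+r)
                                                                    (sym (trans (cong (λ c → ι c * S (suc r)) (nCn≡1 (suc r))) (ℚP.*-identityˡ _))) ⟩
    sum< t (2 ℕ.+ r) - S (suc r)                               ≡⟨ cong (_- S (suc r)) (binomial-residuePowerSum r) ⟩
    (S (suc r) + ι p ^ℚ suc r) - S (suc r)                     ≡⟨ solve 2 (λ a b → (a :+ b) :- a := b) refl (S (suc r)) (ι p ^ℚ suc r) ⟩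
    ι p ^ℚ suc r                                               ∎
    where
    t : ℕ → ℚ
    t j = ι (suc r C j) * S j
    [1+r]Cr≡1+r : suc r C r ≡ suc r
    [1+r]Cr≡1+r = trans (nCk≡nC[n∸k] (ℕP.n≤1+n r)) (trans (cong (suc r C_) (ℕP.m+n∸n≡m 1 r)) (nC1≡n (suc r)))

  ∣-p^ℚ : ∀ r → p^ 1 ∣ ι p ^ℚ suc r
  ∣-p^ℚ r = ∣-*ʳ ∣-p (integral-^ℚ r (integral-ι p))

  ∣-residuePowerSum-< : ∀ r → r < n → p^ 1 ∣ residuePowerSum r
  ∣-residuePowerSum-< = <-rec _ step
    where
    step : ∀ r → (∀ {j} → j < r → j < n → p^ 1 ∣ S j) → r < n → p^ 1 ∣ S r
    step zero    _  _   = subst (p^ 1 ∣_) (sym (sum<-1 p)) ∣-p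
    step (suc r) ih r<n = ∣-cancelˡ-ι (2 ℕ.+ r) (<p⇒p∤ (s≤s z≤n) (s≤s r<n)) (subst (p^ 1 ∣_) eq (∣-- (∣-p^ℚ (suc r)) lower∣))
      where
      t : ℕ → ℚ
      t j = ι (suc (suc r) C j) * S j
      lower∣ : p^ 1 ∣ sum< t (suc r)
      lower∣ = ∣-sum< t (suc r) (λ {j} j<1+r → ∣-* (integral-ι (suc (suc r) C j)) (ih j<1+r (ℕP.<-trans j<1+r r<n)))
      eq : ι p ^ℚ (2 ℕ.+ r) - sum< t (suc r) ≡ ι (2 ℕ.+ r) * S (suc r)
      eq = trans (cong (_- sum< t (suc r)) (sym (residuePowerSum-recurrence (suc r))))
                 (solve 2 (λ a b → (a :+ b) :- b := a) refl (ι (2 ℕ.+ r) * S (suc r)) (sum< t (suc r)))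

  ^ℚ-periodic : ∀ {k} → k < p → ∀ ρ q → ι k ^ℚ (suc ρ ℕ.+ q ℕ.* n) ≡ ι k ^ℚ suc ρ [p^ 1 ]
  ^ℚ-periodic {zero}  _   ρ q = ≡⇒mod (trans (ℚP.*-zeroˡ (0ℚ ^ℚ (ρ ℕ.+ q ℕ.* n))) (sym (ℚP.*-zeroˡ (0ℚ ^ℚ ρ))))
  ^ℚ-periodic {suc k} k<p ρ q = mod-trans (≡⇒mod split)
    (mod-trans (mod-* (integral-^ℚ (suc ρ) (integral-ι (suc k))) (integral-ι 1) (mod-refl (x ^ℚ suc ρ)) x^nq≡1) (≡⇒mod (ℚP.*-identityʳ _)))
    where
    x : ℚ
    x = ι (suc k)
    split : x ^ℚ (suc ρ ℕ.+ q ℕ.* n) ≡ x ^ℚ suc ρ * (x ^ℚ n) ^ℚ q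
    split = trans (^ℚ-distribˡ-+-* x (suc ρ) (q ℕ.* n)) (cong (x ^ℚ suc ρ *_) (trans (cong (x ^ℚ_) (ℕP.*-comm q n)) (sym (^ℚ-*-assoc x n q))))
    x^nq≡1 : (x ^ℚ n) ^ℚ q ≡ 1ℚ [p^ 1 ]
    x^nq≡1 = mod-trans (mod-^ℚ q (integral-^ℚ n (integral-ι (suc k))) (integral-ι 1) (fermat (<p⇒p∤ (s≤s z≤n) k<p))) (≡⇒mod (1^ℚn≡1 q))

  ∣-residuePowerSum : ∀ N → ¬ n ∣ N → p^ 1 ∣ residuePowerSum N
  ∣-residuePowerSum N n∤N with N % n | m≡m%n+[m/n]*n N n | m%n<n N n
  ... | zero   | N≡ | _   = ⊥-elim (n∤N (divides (N / n) N≡))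
  ... | suc ρ  | N≡ | ρ<n = mod-∣ (mod-sum< _ _ p term) (∣-residuePowerSum-< (suc ρ) ρ<n)
    where
    term : ∀ {k} → k < p → ι k ^ℚ N ≡ ι k ^ℚ suc ρ [p^ 1 ]
    term {k} k<p = subst (λ M → ι k ^ℚ M ≡ ι k ^ℚ suc ρ [p^ 1 ]) (sym N≡) (^ℚ-periodic k<p ρ (N / n))

  integral-1/[1+] : ∀ {k} → k < n → Integral 1/[1+ k ]
  integral-1/[1+] {k} k<n = integral-invPow k 1 (<p⇒p∤ (s≤s z≤n) (s≤s k<n))

  ∣-sum<-1/[1+]^ : ∀ m → ¬ n ∣ m → p^ 1 ∣ sum< (λ k → 1/[1+ k ] ^ℚ m) n
  ∣-sum<-1/[1+]^ m n∤m = mod-∣ (mod-sum< _ _ n term) (subst (p^ 1 ∣_) (drop-zero N n∤N) (∣-residuePowerSum N n∤N))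
    where
    N : ℕ
    N = n′ ℕ.* m
    n∤N : ¬ n ∣ N
    n∤N n∣N = n∤m (∣m+n∣m⇒∣n (divides m (trans (ℕP.+-comm N m) (ℕP.*-comm n m))) n∣N)
    drop-zero : ∀ N → ¬ n ∣ N → residuePowerSum N ≡ sum< (λ k → ι (suc k) ^ℚ N) n
    drop-zero zero    n∤0 = ⊥-elim (n∤0 (divides 0 refl))
    drop-zero (suc N) _   = trans (sum<-suc (λ k → ι k ^ℚ suc N) n)
      (trans (cong (_+ sum< (λ k → ι (suc k) ^ℚ suc N) n) (ℚP.*-zeroˡ (0ℚ ^ℚ N))) (ℚP.+-identityˡ _))
    term : ∀ {k} → k < n → 1/[1+ k ] ^ℚ m ≡ ι (suc k) ^ℚ N [p^ 1 ]
    term {k} k<n = mod-trans (mod-^ℚ m (integral-1/[1+] k<n) (integral-^ℚ n′ (integral-ι (suc k))) y≡x^n′) (≡⇒mod (^ℚ-*-assoc (ι (suc k)) n′ m))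
      where
      y≡x^n′ : 1/[1+ k ] ≡ ι (suc k) ^ℚ n′ [p^ 1 ]
      y≡x^n′ = mod-inverse (integral-1/[1+] k<n) (1/[1+]-*-ι k) (fermat (<p⇒p∤ (s≤s z≤n) (s≤s k<n)))

module HarmonicSums (s : ℕ) where

  open SymmetricFunctions using (esym; hsym)
  open import Data.Rational using (ℚ; _+_; _*_)
  open import Data.List using (List; _∷_; reverse; replicate; applyDownFrom; _∷ʳ_)
  import Data.List.Properties as List
  open import Defs using (H; S; Hrev; Srev; rep; invPow)
  open ≡-Reasoning

  private
    reverse-replicate : ∀ {A : Set} l (a : A) → reverse (replicate l a) ≡ replicate l a
    reverse-replicate zero    a = refl
    reverse-replicate (suc l) a = begin
      reverse (a ∷ replicate l a)     ≡⟨ List.unfold-reverse a (replicate l a) ⟩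
      reverse (replicate l a) ∷ʳ a    ≡⟨ cong (_∷ʳ a) (reverse-replicate l a) ⟩
      replicate l a ∷ʳ a              ≡⟨ replicate-∷ʳ l ⟩
      replicate (suc l) a             ∎
      where
      replicate-∷ʳ : ∀ l → replicate l a ∷ʳ a ≡ a ∷ replicate l a
      replicate-∷ʳ zero    = refl
      replicate-∷ʳ (suc l) = cong (a ∷_) (replicate-∷ʳ l)

  invPows : ℕ → List ℚ
  invPows = applyDownFrom (λ m → invPow m s)

  Hrev≡esym : ∀ l n → Hrev (replicate l s) n ≡ esym l (invPows n)
  Hrev≡esym zero    n       = refl
  Hrev≡esym (suc l) zero    = refl
  Hrev≡esym (suc l) (suc n) = cong₂ (λ u v → u + invPow n s * v) (Hrev≡esym (suc l) n) (Hrev≡esym l n)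

  Srev≡hsym : ∀ l n → Srev (replicate l s) n ≡ hsym l (invPows n)
  Srev≡hsym zero    n       = refl
  Srev≡hsym (suc l) zero    = refl
  Srev≡hsym (suc l) (suc n) = cong₂ (λ u v → u + invPow n s * v) (Srev≡hsym (suc l) n) (Srev≡hsym l (suc n))

  H≡esym : ∀ l n → H (rep s l) n ≡ esym l (invPows n)
  H≡esym l n = trans (cong (λ L → Hrev L n) (reverse-replicate l s)) (Hrev≡esym l n)

  S≡hsym : ∀ l n → S (rep s l) n ≡ hsym l (invPows n)
  S≡hsym l n = trans (cong (λ L → Srev L n) (reverse-replicate l s)) (Srev≡hsym l n)

module Parity where

  open import Data.Product using (∃)
  open import Defs using (par)

  even⊎odd : ∀ m → (∃ λ k → m ≡ k ℕ.+ k) ⊎ (∃ λ k → m ≡ suc (k ℕ.+ k))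
  even⊎odd zero          = inj₁ (0 , refl)
  even⊎odd (suc zero)    = inj₂ (0 , refl)
  even⊎odd (suc (suc m)) with even⊎odd m
  ... | inj₁ (k , m≡) = inj₁ (suc k , trans (cong (λ t → suc (suc t)) m≡) (cong suc (sym (ℕP.+-suc k k))))
  ... | inj₂ (k , m≡) = inj₂ (suc k , trans (cong (λ t → suc (suc t)) m≡) (cong (λ t → suc (suc t)) (sym (ℕP.+-suc k k))))

  par-even : ∀ k → par (k ℕ.+ k) ≡ 2
  par-even zero    = refl
  par-even (suc k) = trans (cong (λ t → par (suc t)) (ℕP.+-suc k k)) (par-even k)

  par-odd : ∀ k → par (suc (k ℕ.+ k)) ≡ 1
  par-odd zero    = refl
  par-odd (suc k) = trans (cong (λ t → par (suc (suc t))) (ℕP.+-suc k k)) (par-odd k)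

  par≡1⊎par≡2 : ∀ m → par m ≡ 1 ⊎ par m ≡ 2
  par≡1⊎par≡2 zero          = inj₂ refl
  par≡1⊎par≡2 (suc zero)    = inj₁ refl
  par≡1⊎par≡2 (suc (suc m)) = par≡1⊎par≡2 m

module Congruences (n′ : ℕ) (p-prime : Prime (2 ℕ.+ n′)) (s : ℕ) where

  open Arithmetic
  open SymmetricFunctions
  open PowerSums n′ p-prime
  open HarmonicSums s using (invPows)
  open Parity
  open import Data.Rational as ℚ using (ℚ; 0ℚ; 1ℚ; _+_; _*_; _-_; -_)
  import Data.Rational.Properties as ℚP
  open import Data.Rational.Solver using (module +-*-Solver)
  open +-*-Solver
  open import Data.List using (List; []; _∷_; map; applyDownFrom)
  import Data.List.Properties as List
  open import Data.List.Relation.Unary.All as All using (All; []; _∷_)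
  import Data.List.Relation.Unary.All.Properties as AllP
  open import Data.List.Relation.Binary.Pointwise using (Pointwise; []; _∷_)
  open import Data.List.Relation.Binary.Permutation.Propositional using (_↭_)
  open import Data.List.Relation.Binary.Permutation.Propositional.Properties using (↭-reverse)
  open import Data.Nat.Divisibility using (_∣_; _∣?_; divides; ∣m∣n⇒∣m+n)
  open import Data.Nat.Induction using (<-rec)
  open import Defs using (par; invPow)
  open ≡-Reasoning

  IntegralPair : ℚ × ℚ → Set
  IntegralPair ab = Integral (proj₁ ab) × Integral (proj₂ ab)

  integral-esym : ∀ {L} → All Integral L → ∀ j → Integral (esym j L)
  integral-esym _          zero    = integral-ι 1
  integral-esym []         (suc j) = ∣-0 0
  integral-esym (a∣ ∷ L∣)  (suc j) = ∣-+ (integral-esym L∣ (suc j)) (∣-* a∣ (integral-esym L∣ j))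

  integral-hsym : ∀ {L} → All Integral L → ∀ j → Integral (hsym j L)
  integral-hsym _          zero    = integral-ι 1
  integral-hsym []         (suc j) = ∣-0 0
  integral-hsym (a∣ ∷ L∣)  (suc j) = ∣-+ (integral-hsym L∣ (suc j)) (∣-* a∣ (integral-hsym (a∣ ∷ L∣) j))

  private
    integral-proj₁ : ∀ {L} → All IntegralPair L → All Integral (map proj₁ L)
    integral-proj₁ L∣ = AllP.map⁺ (All.map proj₁ L∣)

  integral-∂esym : ∀ {L} → All IntegralPair L → ∀ j → Integral (∂esym j L)
  integral-∂esym _                  zero    = ∣-0 0
  integral-∂esym []                 (suc j) = ∣-0 0
  integral-∂esym ((a∣ , b∣) ∷ L∣)   (suc j) =
    ∣-+ (∣-+ (integral-∂esym L∣ (suc j)) (∣-* a∣ (integral-∂esym L∣ j))) (∣-* b∣ (integral-esym (integral-proj₁ L∣) j))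

  integral-∂hsym : ∀ {L} → All IntegralPair L → ∀ j → Integral (∂hsym j L)
  integral-∂hsym _                  zero    = ∣-0 0
  integral-∂hsym []                 (suc j) = ∣-0 0
  integral-∂hsym ((a∣ , b∣) ∷ L∣)   (suc j) =
    ∣-+ (∣-+ (integral-∂hsym L∣ (suc j)) (∣-* a∣ (integral-∂hsym ((a∣ , b∣) ∷ L∣) j))) (∣-* b∣ (integral-hsym (a∣ ∷ integral-proj₁ L∣) j))

  ∣-⋆ : ∀ {e} f g j → (∀ a b → a ℕ.+ b ≡ j → p^ e ∣ f a * g b) → p^ e ∣ (f ⋆ g) j
  ∣-⋆ f g zero    fg∣ = fg∣ 0 0 refl
  ∣-⋆ f g (suc j) fg∣ = ∣-+ (fg∣ (suc j) 0 (ℕP.+-identityʳ (suc j)))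
    (∣-⋆ f (λ i → g (suc i)) j (λ a b a+b≡j → fg∣ a (suc b) (trans (ℕP.+-suc a b) (cong suc a+b≡j))))

  -- If j·eⱼ = Σ_{a+b=j-1} e_a g_b and p | g_b whenever n ∤ (b+1)s, then p | eⱼ whenever n ∤ js:
  -- in each term either n ∤ (b+1)s, or n | (b+1)s and then n ∤ as.
  ∣-newton : ∀ (e g : ℕ → ℚ) → (∀ j → Integral (e j)) → (∀ b → Integral (g b)) →
    (∀ b → ¬ n ∣ (suc b ℕ.* s) → p^ 1 ∣ g b) → (∀ j → ι (suc j) * e (suc j) ≡ (e ⋆ g) j) →
    ∀ j → j < p → ¬ n ∣ (j ℕ.* s) → p^ 1 ∣ e j
  ∣-newton e g e∣ g∣ g∣p newton = <-rec _ step
    where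
    step : ∀ j → (∀ {a} → a < j → a < p → ¬ n ∣ (a ℕ.* s) → p^ 1 ∣ e a) → j < p → ¬ n ∣ (j ℕ.* s) → p^ 1 ∣ e j
    step zero     _  _   n∤0   = ⊥-elim (n∤0 (divides 0 refl))
    step (suc j′) ih j<p n∤js = ∣-cancelˡ-ι (suc j′) (<p⇒p∤ (s≤s z≤n) j<p) (subst (p^ 1 ∣_) (sym (newton j′)) (∣-⋆ e g j′ term))
      where
      term : ∀ a b → a ℕ.+ b ≡ j′ → p^ 1 ∣ e a * g b
      term a b a+b≡j′ with n ∣? (suc b ℕ.* s)
      ... | no  n∤bs = ∣-* (e∣ a) (g∣p b n∤bs)
      ... | yes n∣bs = ∣-*ʳ (ih a<j (ℕP.<-trans a<j j<p) n∤as) (g∣ b)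
        where
        a<j : a < suc j′
        a<j = s≤s (subst (a ℕ.≤_) a+b≡j′ (ℕP.m≤m+n a b))
        n∤as : ¬ n ∣ (a ℕ.* s)
        n∤as n∣as = n∤js (subst (n ∣_) (trans (sym (ℕP.*-distribʳ-+ s a (suc b))) (cong (ℕ._* s) (trans (ℕP.+-suc a b) (cong suc a+b≡j′))))
                                 (∣m∣n⇒∣m+n n∣as n∣bs))

  xs : List ℚ
  xs = invPows n

  integral-invPow-< : ∀ {k} → k < n → Integral (invPow k s)
  integral-invPow-< {k} k<n = integral-invPow k s (<p⇒p∤ (s≤s z≤n) (s≤s k<n))

  integral-xs : All Integral xs
  integral-xs = All-applyDownFrom n integral-invPow-<

  private
    P : ℕ → ℚ
    P m = sum< (λ k → 1/[1+ k ] ^ℚ m) n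

    integral-P : ∀ m → Integral (P m)
    integral-P m = ∣-sum< _ n (λ k<n → integral-^ℚ m (integral-1/[1+] k<n))

    ∣-P : ∀ b → ¬ n ∣ (suc b ℕ.* s) → p^ 1 ∣ P (s ℕ.* suc b)
    ∣-P b n∤bs = ∣-sum<-1/[1+]^ (s ℕ.* suc b) (λ n∣sb → n∤bs (subst (n ∣_) (ℕP.*-comm s (suc b)) n∣sb))

    diag-xs : diag xs ≡ applyDownFrom (λ k → invPow k s , invPow k s) n
    diag-xs = List.map-applyDownFrom (λ k → invPow k s) (λ a → a , a) n

    powerSum-diag : ∀ b → weightedPowerSum (diag xs) b ≡ P (s ℕ.* suc b)
    powerSum-diag b = begin
      weightedPowerSum (diag xs) b                        ≡⟨ cong (λ L → weightedPowerSum L b) diag-xs ⟩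
      _                                                   ≡⟨ weightedPowerSum-applyDownFrom (λ k → invPow k s) (λ k → invPow k s) n b ⟩
      sum< (λ k → invPow k s * invPow k s ^ℚ b) n         ≡⟨ sum<-cong n (λ {k} _ → trans (cong (λ y → y * y ^ℚ b) (invPow≡1/[1+]^ k s))
                                                               (^ℚ-*-assoc 1/[1+ k ] s (suc b))) ⟩
      P (s ℕ.* suc b)                                     ∎

    powerSum⁻-diag : ∀ b → weightedPowerSum⁻ (diag xs) b ≡ (- 1ℚ) ^ℚ b * P (s ℕ.* suc b)
    powerSum⁻-diag b = begin
      weightedPowerSum⁻ (diag xs) b                       ≡⟨ cong (λ L → weightedPowerSum⁻ L b) diag-xs ⟩
      _                                                   ≡⟨ weightedPowerSum⁻-applyDownFrom (λ k → invPow k s) (λ k → invPow k s) n b ⟩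
      sum< (λ k → invPow k s * (- invPow k s) ^ℚ b) n     ≡⟨ sum<-cong n (λ {k} _ → trans (cong (λ y → y * (- y) ^ℚ b) (invPow≡1/[1+]^ k s)) (sign k)) ⟩
      sum< (λ k → (- 1ℚ) ^ℚ b * 1/[1+ k ] ^ℚ (s ℕ.* suc b)) n
                                                          ≡⟨ sum<-*ˡ ((- 1ℚ) ^ℚ b) _ n ⟩
      (- 1ℚ) ^ℚ b * P (s ℕ.* suc b)                       ∎
      where
      sign : ∀ k → 1/[1+ k ] ^ℚ s * (- 1/[1+ k ] ^ℚ s) ^ℚ b ≡ (- 1ℚ) ^ℚ b * 1/[1+ k ] ^ℚ (s ℕ.* suc b)
      sign k = begin
        y ^ℚ s * (- y ^ℚ s) ^ℚ b                  ≡⟨ cong (y ^ℚ s *_) (neg-^ℚ (y ^ℚ s) b) ⟩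
        y ^ℚ s * ((- 1ℚ) ^ℚ b * (y ^ℚ s) ^ℚ b)    ≡⟨ solve 3 (λ a c w → a :* (c :* w) := c :* (a :* w)) refl (y ^ℚ s) ((- 1ℚ) ^ℚ b) ((y ^ℚ s) ^ℚ b) ⟩
        (- 1ℚ) ^ℚ b * (y ^ℚ s) ^ℚ suc b           ≡⟨ cong ((- 1ℚ) ^ℚ b *_) (^ℚ-*-assoc y s (suc b)) ⟩
        (- 1ℚ) ^ℚ b * y ^ℚ (s ℕ.* suc b)          ∎
        where
        y : ℚ
        y = 1/[1+ k ]

  ∣-esym : ∀ l → l < p → ¬ n ∣ (l ℕ.* s) → p^ 1 ∣ esym l xs
  ∣-esym = ∣-newton (λ j → esym j xs) (weightedPowerSum⁻ (diag xs)) (integral-esym integral-xs)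
    (λ b → subst Integral (sym (powerSum⁻-diag b)) (∣-* (integral-^ℚ b (∣-neg (integral-ι 1))) (integral-P (s ℕ.* suc b))))
    (λ b n∤bs → subst (p^ 1 ∣_) (sym (powerSum⁻-diag b)) (∣-* (integral-^ℚ b (∣-neg (integral-ι 1))) (∣-P b n∤bs)))
    (newton-esym xs)

  ∣-hsym : ∀ l → l < p → ¬ n ∣ (l ℕ.* s) → p^ 1 ∣ hsym l xs
  ∣-hsym = ∣-newton (λ j → hsym j xs) (weightedPowerSum (diag xs)) (integral-hsym integral-xs)
    (λ b → subst Integral (sym (powerSum-diag b)) (integral-P (s ℕ.* suc b)))
    (λ b n∤bs → subst (p^ 1 ∣_) (sym (powerSum-diag b)) (∣-P b n∤bs))
    (newton-hsym xs)

  private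
    first-order-* : ∀ {u v C D} → Integral v → Integral D → (u + ι p * v) * (C + ι p * D) ≡ u * C + ι p * (u * D + v * C) [p^ 2 ]
    first-order-* {u} {v} {C} {D} v∣ D∣ = mod (subst (p^ 2 ∣_) eq (∣-*ʳ (∣-* ∣-p ∣-p) (∣-* v∣ D∣)))
      where
      eq : ι p * ι p * (v * D) ≡ (u + ι p * v) * (C + ι p * D) - (u * C + ι p * (u * D + v * C))
      eq = solve 5 (λ P u v C D → P :* P :* (v :* D) := (u :+ P :* v) :* (C :+ P :* D) :- (u :* C :+ P :* (u :* D :+ v :* C))) refl (ι p) u v C D

    first-order-step : ∀ {z u v a A B c C D} → Integral u → Integral v → Integral C → Integral D →
      z ≡ u + ι p * v [p^ 2 ] → a ≡ A + ι p * B [p^ 2 ] → c ≡ C + ι p * D [p^ 2 ] →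
      a + z * c ≡ (A + u * C) + ι p * (B + u * D + v * C) [p^ 2 ]
    first-order-step {z} {u} {v} {a} {A} {B} {c} {C} {D} u∣ v∣ C∣ D∣ z≡ a≡ c≡ =
      mod-trans (mod-+ a≡ (mod-trans (mod-* z∣ (∣-+ C∣ (∣-* (integral-ι p) D∣)) z≡ c≡) (first-order-* {u} {v} {C} {D} v∣ D∣))) (≡⇒mod eq)
      where
      z∣ : Integral z
      z∣ = mod-integral z≡ (∣-+ u∣ (∣-* (integral-ι p) v∣))
      eq : (A + ι p * B) + (u * C + ι p * (u * D + v * C)) ≡ (A + u * C) + ι p * (B + u * D + v * C)
      eq = solve 7 (λ P A B u C D v → (A :+ P :* B) :+ (u :* C :+ P :* (u :* D :+ v :* C)) := (A :+ u :* C) :+ P :* (B :+ u :* D :+ v :* C))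
             refl (ι p) A B u C D v

  FirstOrder : ℚ → ℚ × ℚ → Set
  FirstOrder z uv = z ≡ proj₁ uv + ι p * proj₂ uv [p^ 2 ]

  esym-first-order : ∀ {zs L} → All IntegralPair L → Pointwise FirstOrder zs L →
    ∀ j → esym j zs ≡ esym j (map proj₁ L) + ι p * ∂esym j L [p^ 2 ]
  esym-first-order _ _ zero = ≡⇒mod (solve 1 (λ P → con 1ℚ := con 1ℚ :+ P :* con 0ℚ) refl (ι p))
  esym-first-order [] [] (suc j) = ≡⇒mod (solve 1 (λ P → con 0ℚ := con 0ℚ :+ P :* con 0ℚ) refl (ι p))
  esym-first-order {L = (u , v) ∷ L} ((u∣ , v∣) ∷ L∣) (z≡ ∷ zs≡) (suc j) =
    first-order-step {A = esym (suc j) (map proj₁ L)} {B = ∂esym (suc j) L} u∣ v∣ (integral-esym (integral-proj₁ L∣) j) (integral-∂esym L∣ j) z≡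
      (esym-first-order L∣ zs≡ (suc j)) (esym-first-order L∣ zs≡ j)

  hsym-first-order : ∀ {zs L} → All IntegralPair L → Pointwise FirstOrder zs L →
    ∀ j → hsym j zs ≡ hsym j (map proj₁ L) + ι p * ∂hsym j L [p^ 2 ]
  hsym-first-order _ _ zero = ≡⇒mod (solve 1 (λ P → con 1ℚ := con 1ℚ :+ P :* con 0ℚ) refl (ι p))
  hsym-first-order [] [] (suc j) = ≡⇒mod (solve 1 (λ P → con 0ℚ := con 0ℚ :+ P :* con 0ℚ) refl (ι p))
  hsym-first-order {L = (u , v) ∷ L} ((u∣ , v∣) ∷ L∣) (z≡ ∷ zs≡) (suc j) =
    first-order-step {A = hsym (suc j) (map proj₁ L)} {B = ∂hsym (suc j) L} u∣ v∣ (integral-hsym (u∣ ∷ integral-proj₁ L∣) j) (integral-∂hsym ((u∣ , v∣) ∷ L∣) j) z≡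
      (hsym-first-order L∣ zs≡ (suc j)) (hsym-first-order ((u∣ , v∣) ∷ L∣) (z≡ ∷ zs≡) j)

  -- From w·A = 1, y·K = 1 and A + K = p: w − (−y − p y²) = p² w y².
  inverse-of-complement : ∀ {w y A K} → Integral w → Integral y → w * A ≡ 1ℚ → y * K ≡ 1ℚ → A + K ≡ ι p →
    w ≡ - y - ι p * y * y [p^ 2 ]
  inverse-of-complement {w} {y} {A} {K} w∣ y∣ wA≡1 yK≡1 A+K≡p = mod (subst (p^ 2 ∣_) (sym eq) (∣-*ʳ (∣-* ∣-p ∣-p) (∣-* w∣ (∣-* y∣ y∣))))
    where
    eq : w - (- y - ι p * y * y) ≡ ι p * ι p * (w * (y * y))
    eq = begin
      w - (- y - ι p * y * y)                    ≡⟨ cong (λ P → w - (- y - P * y * y)) (sym A+K≡p) ⟩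
      w - (- y - (A + K) * y * y)                ≡⟨ solve 4 (λ w y A K → w :- (:- y :- (A :+ K) :* y :* y)
                                                       := (A :+ K) :* (A :+ K) :* (w :* (y :* y)) :+ w :* (con 1ℚ :- y :* K) :* (con 1ℚ :+ (A :+ K) :* y)
                                                          :+ (con 1ℚ :- w :* A) :* (y :+ (A :+ K) :* y :* y)) refl w y A K ⟩
      (A + K) * (A + K) * (w * (y * y)) + w * (1ℚ - y * K) * (1ℚ + (A + K) * y) + (1ℚ - w * A) * (y + (A + K) * y * y)
                                                 ≡⟨ cong₂ (λ a b → (A + K) * (A + K) * (w * (y * y)) + w * (1ℚ - a) * (1ℚ + (A + K) * y) + (1ℚ - b) * (y + (A + K) * y * y))
                                                      yK≡1 wA≡1 ⟩
      (A + K) * (A + K) * (w * (y * y)) + w * (1ℚ - 1ℚ) * (1ℚ + (A + K) * y) + (1ℚ - 1ℚ) * (y + (A + K) * y * y)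
                                                 ≡⟨ solve 4 (λ w y A K → (A :+ K) :* (A :+ K) :* (w :* (y :* y)) :+ w :* (con 1ℚ :- con 1ℚ) :* (con 1ℚ :+ (A :+ K) :* y)
                                                       :+ (con 1ℚ :- con 1ℚ) :* (y :+ (A :+ K) :* y :* y) := (A :+ K) :* (A :+ K) :* (w :* (y :* y))) refl w y A K ⟩
      (A + K) * (A + K) * (w * (y * y))          ≡⟨ cong (λ P → P * P * (w * (y * y))) A+K≡p ⟩
      ι p * ι p * (w * (y * y))                  ∎

  binomial-first-order : ∀ {t} → Integral t → ∀ k → (1ℚ + ι p * t) ^ℚ k ≡ 1ℚ + ι k * ι p * t [p^ 2 ]
  binomial-first-order {t} t∣ zero    = ≡⇒mod (solve 2 (λ P t → con 1ℚ := con 1ℚ :+ con 0ℚ :* P :* t) refl (ι p) t)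
  binomial-first-order {t} t∣ (suc k) =
    mod-trans (mod-* 1+pt∣ (∣-+ (integral-ι 1) (∣-* (∣-* (integral-ι k) (integral-ι p)) t∣)) (mod-refl (1ℚ + ι p * t)) (binomial-first-order t∣ k))
              (mod (subst (p^ 2 ∣_) eq (∣-*ʳ (∣-* ∣-p ∣-p) (∣-* (integral-ι k) (∣-* t∣ t∣)))))
    where
    1+pt∣ : Integral (1ℚ + ι p * t)
    1+pt∣ = ∣-+ (integral-ι 1) (∣-* (integral-ι p) t∣)
    eq : ι p * ι p * (ι k * (t * t)) ≡ (1ℚ + ι p * t) * (1ℚ + ι k * ι p * t) - (1ℚ + ι (suc k) * ι p * t)
    eq = trans (solve 3 (λ P k t → P :* P :* (k :* (t :* t)) := (con 1ℚ :+ P :* t) :* (con 1ℚ :+ k :* P :* t) :- (con 1ℚ :+ (con 1ℚ :+ k) :* P :* t)) refl (ι p) (ι k) t)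
               (cong (λ z → (1ℚ + ι p * t) * (1ℚ + ι k * ι p * t) - (1ℚ + z * ι p * t)) (sym (ι-suc k)))

  c : ℚ
  c = (- 1ℚ) ^ℚ s

  firstOrderTerms : ℕ → ℚ × ℚ
  firstOrderTerms k = c * invPow k s , c * ι s * invPow k s * 1/[1+ k ]

  -- 1/(p−k−1)^s ≡ (−1/(k+1) − p/(k+1)²)^s ≡ (−1)^s (k+1)^{−s} (1 + s p/(k+1)) (mod p²)
  reflection : ∀ {k} → k < n → FirstOrder (invPow (n ∸ suc k) s) (firstOrderTerms k)
  reflection {k} k<n = mod-trans (≡⇒mod (invPow≡1/[1+]^ (n ∸ suc k) s))
    (mod-trans (mod-^ℚ s w∣ (∣-- (∣-neg y∣) (∣-*ʳ (∣-* (integral-ι p) y∣) y∣)) w≡)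
    (mod-trans (≡⇒mod factor)
    (mod-trans (mod-* (integral-^ℚ s (∣-neg y∣)) (∣-+ (integral-ι 1) (∣-* (∣-* (integral-ι s) (integral-ι p)) y∣))
                      (mod-refl ((- y) ^ℚ s)) (binomial-first-order y∣ s))
    (≡⇒mod expand))))
    where
    w y : ℚ
    w = 1/[1+ n ∸ suc k ]
    y = 1/[1+ k ]
    y∣ : Integral y
    y∣ = integral-1/[1+] k<n
    w∣ : Integral w
    w∣ = integral-1/[1+] (s≤s (ℕP.m∸n≤m n′ k))
    w≡ : w ≡ - y - ι p * y * y [p^ 2 ]
    w≡ = inverse-of-complement w∣ y∣ (1/[1+]-*-ι (n ∸ suc k)) (1/[1+]-*-ι k)
      (trans (sym (ι-+ (suc (n ∸ suc k)) (suc k))) (cong (λ m → ι (suc m)) (ℕP.m∸n+n≡m k<n)))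
    factor : (- y - ι p * y * y) ^ℚ s ≡ (- y) ^ℚ s * (1ℚ + ι p * y) ^ℚ s
    factor = trans (cong (_^ℚ s) (solve 2 (λ y P → :- y :- P :* y :* y := (:- y) :* (con 1ℚ :+ P :* y)) refl y (ι p))) (^ℚ-distribʳ-* (- y) (1ℚ + ι p * y) s)
    expand : (- y) ^ℚ s * (1ℚ + ι s * ι p * y) ≡ proj₁ (firstOrderTerms k) + ι p * proj₂ (firstOrderTerms k)
    expand = begin
      (- y) ^ℚ s * (1ℚ + ι s * ι p * y)               ≡⟨ cong (_* (1ℚ + ι s * ι p * y)) (neg-^ℚ y s) ⟩
      c * y ^ℚ s * (1ℚ + ι s * ι p * y)               ≡⟨ solve 5 (λ c X S P y → c :* X :* (con 1ℚ :+ S :* P :* y) := c :* X :+ P :* (c :* S :* X :* y))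
                                                           refl c (y ^ℚ s) (ι s) (ι p) y ⟩
      c * y ^ℚ s + ι p * (c * ι s * y ^ℚ s * y)       ≡⟨ cong (λ X → c * X + ι p * (c * ι s * X * y)) (sym (invPow≡1/[1+]^ k s)) ⟩
      c * invPow k s + ι p * (c * ι s * invPow k s * y) ∎

  private
    R : List (ℚ × ℚ)
    R = applyDownFrom firstOrderTerms n

    c∣ : Integral c
    c∣ = integral-^ℚ s (∣-neg (integral-ι 1))

    integral-R : All IntegralPair R
    integral-R = All-applyDownFrom n (λ k<n →
      ∣-* c∣ (integral-invPow-< k<n) , ∣-*ʳ (∣-*ʳ (∣-* c∣ (integral-ι s)) (integral-invPow-< k<n)) (integral-1/[1+] k<n))

    map-proj₁-R : map proj₁ R ≡ map (c *_) xs
    map-proj₁-R = trans (List.map-applyDownFrom firstOrderTerms proj₁ n) (sym (List.map-applyDownFrom (λ k → invPow k s) (c *_) n))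

    reflected↭xs : applyDownFrom (λ k → invPow (n ∸ suc k) s) n ↭ xs
    reflected↭xs = subst (_↭ xs) (trans (List.reverse-applyDownFrom (λ k → invPow k s) n) (sym (applyDownFrom-reflect (λ k → invPow k s) n))) (↭-reverse xs)

    esym-reflection : ∀ l → esym l xs ≡ c ^ℚ l * esym l xs + ι p * ∂esym l R [p^ 2 ]
    esym-reflection l = mod-trans (≡⇒mod (sym (esym-↭ reflected↭xs l)))
      (mod-trans (esym-first-order integral-R (Pointwise-applyDownFrom n reflection) l)
                 (≡⇒mod (cong (λ L → L + ι p * ∂esym l R) (trans (cong (esym l) map-proj₁-R) (esym-map-* c xs l)))))

    hsym-reflection : ∀ l → hsym l xs ≡ c ^ℚ l * hsym l xs + ι p * ∂hsym l R [p^ 2 ]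
    hsym-reflection l = mod-trans (≡⇒mod (sym (hsym-↭ reflected↭xs l)))
      (mod-trans (hsym-first-order integral-R (Pointwise-applyDownFrom n reflection) l)
                 (≡⇒mod (cong (λ L → L + ι p * ∂hsym l R) (trans (cong (hsym l) map-proj₁-R) (hsym-map-* c xs l)))))

    weighted-term : ∀ c′ k b → proj₂ (firstOrderTerms k) * (c′ * invPow k s) ^ℚ b
                               ≡ (c * ι s * c′ ^ℚ b) * 1/[1+ k ] ^ℚ suc (s ℕ.* suc b)
    weighted-term c′ k b = begin
      c * ι s * X * y * (c′ * X) ^ℚ b           ≡⟨ cong (c * ι s * X * y *_) (^ℚ-distribʳ-* c′ X b) ⟩
      c * ι s * X * y * (c′ ^ℚ b * X ^ℚ b)      ≡⟨ solve 6 (λ c S X y a w → c :* S :* X :* y :* (a :* w) := c :* S :* a :* (y :* (X :* w))) refl c (ι s) X y (c′ ^ℚ b) (X ^ℚ b) ⟩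
      (c * ι s * c′ ^ℚ b) * (y * X ^ℚ suc b)    ≡⟨ cong (λ t → (c * ι s * c′ ^ℚ b) * (y * t)) (trans (cong (_^ℚ suc b) (invPow≡1/[1+]^ k s)) (^ℚ-*-assoc y s (suc b))) ⟩
      (c * ι s * c′ ^ℚ b) * y ^ℚ suc (s ℕ.* suc b) ∎
      where
      X y : ℚ
      X = invPow k s
      y = 1/[1+ k ]

    ∣-weighted : ∀ l (c′ : ℚ) (g : ℕ → ℚ) → Integral c′ →
      (∀ b → g b ≡ sum< (λ k → proj₂ (firstOrderTerms k) * (c′ * invPow k s) ^ℚ b) n) →
      (∀ b → b < l → ¬ n ∣ (suc b ℕ.* s ℕ.+ 1)) → ∀ b → b < l → p^ 1 ∣ g b
    ∣-weighted l c′ g c′∣ g≡ n∤ b b<l = subst (p^ 1 ∣_) (sym (trans (g≡ b) (trans (sum<-cong n (λ {k} _ → weighted-term c′ k b)) (sum<-*ˡ (c * ι s * c′ ^ℚ b) (λ k → 1/[1+ k ] ^ℚ suc (s ℕ.* suc b)) n))))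
      (∣-* (∣-* (∣-* c∣ (integral-ι s)) (integral-^ℚ b c′∣))
            (∣-sum<-1/[1+]^ (suc (s ℕ.* suc b)) (λ n∣ → n∤ b b<l (subst (n ∣_) (trans (ℕP.+-comm 1 _) (cong (ℕ._+ 1) (ℕP.*-comm s (suc b)))) n∣))))

    weightedPowerSum⁻-R : ∀ b → weightedPowerSum⁻ R b ≡ sum< (λ k → proj₂ (firstOrderTerms k) * (- 1ℚ * c * invPow k s) ^ℚ b) n
    weightedPowerSum⁻-R b = trans (weightedPowerSum⁻-applyDownFrom (λ k → c * invPow k s) (λ k → proj₂ (firstOrderTerms k)) n b)
      (sum<-cong n (λ {k} _ → cong (λ t → proj₂ (firstOrderTerms k) * t ^ℚ b) (solve 2 (λ c X → :- (c :* X) := :- con 1ℚ :* c :* X) refl c (invPow k s))))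

    ∣-∂esym-R : ∀ l′ → (∀ b → b < suc l′ → ¬ n ∣ (suc b ℕ.* s ℕ.+ 1)) → p^ 1 ∣ ∂esym (suc l′) R
    ∣-∂esym-R l′ n∤ = subst (p^ 1 ∣_) (sym (∂esym-newton R l′)) (∣-⋆ _ _ l′ λ a b a+b≡l′ →
      ∣-* (integral-esym (integral-proj₁ integral-R) a)
           (∣-weighted (suc l′) (- 1ℚ * c) (weightedPowerSum⁻ R) (∣-* (∣-neg (integral-ι 1)) c∣) weightedPowerSum⁻-R n∤ b
             (s≤s (subst (b ℕ.≤_) a+b≡l′ (ℕP.m≤n+m b a)))))

    ∣-∂hsym-R : ∀ l′ → (∀ b → b < suc l′ → ¬ n ∣ (suc b ℕ.* s ℕ.+ 1)) → p^ 1 ∣ ∂hsym (suc l′) R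
    ∣-∂hsym-R l′ n∤ = subst (p^ 1 ∣_) (sym (∂hsym-newton R l′)) (∣-⋆ _ _ l′ λ a b a+b≡l′ →
      ∣-* (integral-hsym (integral-proj₁ integral-R) a)
           (∣-weighted (suc l′) c (weightedPowerSum R) c∣ (weightedPowerSum-applyDownFrom (λ k → c * invPow k s) (λ k → proj₂ (firstOrderTerms k)) n) n∤ b
             (s≤s (subst (b ℕ.≤_) a+b≡l′ (ℕP.m≤n+m b a)))))

    c^l≡-1 : ∀ l k → l ℕ.* s ≡ suc (k ℕ.+ k) → c ^ℚ l ≡ - 1ℚ
    c^l≡-1 l k ls≡ = trans (^ℚ-*-assoc (- 1ℚ) s l) (trans (cong ((- 1ℚ) ^ℚ_) (trans (ℕP.*-comm s l) ls≡)) ([-1]^odd≡-1 k))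

    c^l*x≡-x : ∀ {l k} → l ℕ.* s ≡ suc (k ℕ.+ k) → ∀ x → c ^ℚ l * x ≡ - x
    c^l*x≡-x {l} {k} ls≡ x = trans (cong (_* x) (c^l≡-1 l k ls≡)) (trans (sym (ℚP.neg-distribˡ-* 1ℚ x)) (cong (λ t → - t) (ℚP.*-identityˡ x)))

  p²∣esym : ¬ p ∣ 2 → ∀ l k → l ℕ.* s ≡ suc (k ℕ.+ k) → (∀ b → b < l → ¬ n ∣ (suc b ℕ.* s ℕ.+ 1)) → p^ 2 ∣ esym l xs
  p²∣esym p∤2 (suc l′) k ls≡ n∤ = ≡-neg+p*⇒∣ p∤2
    (mod-trans (esym-reflection (suc l′)) (≡⇒mod (cong (_+ ι p * ∂esym (suc l′) R) (c^l*x≡-x {suc l′} {k} ls≡ (esym (suc l′) xs)))))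
    (∣-∂esym-R l′ n∤)

  p²∣hsym : ¬ p ∣ 2 → ∀ l k → l ℕ.* s ≡ suc (k ℕ.+ k) → (∀ b → b < l → ¬ n ∣ (suc b ℕ.* s ℕ.+ 1)) → p^ 2 ∣ hsym l xs
  p²∣hsym p∤2 (suc l′) k ls≡ n∤ = ≡-neg+p*⇒∣ p∤2
    (mod-trans (hsym-reflection (suc l′)) (≡⇒mod (cong (_+ ι p * ∂hsym (suc l′) R) (c^l*x≡-x {suc l′} {k} ls≡ (hsym (suc l′) xs)))))
    (∣-∂hsym-R l′ n∤)

  ∣-esym×∣-hsym : ∀ l → ¬ p ∣ 2 → l < p → ¬ n ∣ (l ℕ.* s) → (∀ b → b < l → ¬ n ∣ (suc b ℕ.* s ℕ.+ 1)) →
    p^ par (l ℕ.* s ∸ 1) ∣ esym l xs × p^ par (l ℕ.* s ∸ 1) ∣ hsym l xs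
  ∣-esym×∣-hsym l p∤2 l<p n∤ls n∤ with even⊎odd (l ℕ.* s)
  ... | inj₁ (zero , ls≡)  = ⊥-elim (n∤ls (subst (n ∣_) (sym ls≡) (divides 0 refl)))
  ... | inj₁ (suc k , ls≡) = subst (λ e → p^ e ∣ esym l xs × p^ e ∣ hsym l xs) (sym par≡1) (∣-esym l l<p n∤ls , ∣-hsym l l<p n∤ls)
    where
    par≡1 : par (l ℕ.* s ∸ 1) ≡ 1
    par≡1 = trans (cong (λ m → par (m ∸ 1)) ls≡) (trans (cong par (ℕP.+-suc k k)) (par-odd k))
  ... | inj₂ (k , ls≡)     = subst (λ e → p^ e ∣ esym l xs × p^ e ∣ hsym l xs) (sym par≡2) (p²∣esym p∤2 l k ls≡ n∤ , p²∣hsym p∤2 l k ls≡ n∤)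
    where
    par≡2 : par (l ℕ.* s ∸ 1) ≡ 2
    par≡2 = trans (cong (λ m → par (m ∸ 1)) ls≡) (par-even k)

module OddPrime (n″ : ℕ) (p-prime : Prime (3 ℕ.+ n″)) where

  import Data.Product as Product

  open import Data.Nat using (_+_; _*_; _^_)
  open import Data.Nat.Divisibility using (_∣_; ∣⇒≤; >⇒∤)
  open import Defs using (H; S; rep; par; _≡0mod_)
  open PowerSums (suc n″) p-prime using (n; p; p^_∣_; p^∣⇒≡0mod; ∣-pred)
  open HarmonicSums using (H≡esym; S≡hsym)
  open Parity using (par≡1⊎par≡2)

  p∤2 : ¬ p ∣ 2
  p∤2 p∣2 with ∣⇒≤ p∣2
  ... | s≤s (s≤s ())

  ∤-between : ∀ {m} → 0 < m → m < n → ¬ n ∣ m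
  ∤-between 0<m m<n = >⇒∤ {{ℕ.>-nonZero 0<m}} m<n

  H∣×S∣ : ∀ s l → l + 2 ≤ p → ¬ (n ∣ (s * l)) → ((k : ℕ) → 1 ≤ k → k ≤ l → ¬ (n ∣ (k * s + 1))) →
    p^ par (l * s ∸ 1) ∣ H (rep s l) n × p^ par (l * s ∸ 1) ∣ S (rep s l) n
  H∣×S∣ s l l+2≤p n∤sl n∤ks+1 = Product.map
    (subst (p^ par (l * s ∸ 1) ∣_) (sym (H≡esym s l n)))
    (subst (p^ par (l * s ∸ 1) ∣_) (sym (S≡hsym s l n)))
    (∣-esym×∣-hsym l p∤2 (ℕP.<-≤-trans (ℕP.m<m+n l (s≤s z≤n)) l+2≤p) (λ n∣ls → n∤sl (subst (n ∣_) (ℕP.*-comm l s) n∣ls))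
      (λ b b<l → n∤ks+1 (suc b) (s≤s z≤n) b<l))
    where open Congruences (suc n″) p-prime s using (∣-esym×∣-hsym)

  large-p-hypotheses : ∀ s l → 1 ≤ s → 1 ≤ l → l * s + 3 ≤ p →
    l + 2 ≤ p × ¬ (n ∣ (s * l)) × ((k : ℕ) → 1 ≤ k → k ≤ l → ¬ (n ∣ (k * s + 1)))
  large-p-hypotheses s l (s≤s z≤n) (s≤s z≤n) ls+3≤p = l+2≤p , n∤sl , n∤ks+1
    where
    ls+2≤n : l * s + 2 ≤ n
    ls+2≤n = ℕP.≤-pred (subst (_≤ p) (ℕP.+-suc (l * s) 2) ls+3≤p)
    l+2≤p : l + 2 ≤ p
    l+2≤p = ℕP.≤-trans (ℕP.+-monoˡ-≤ 2 (ℕP.m≤m*n l s)) (ℕP.≤-trans (ℕP.+-monoʳ-≤ (l * s) (ℕP.n≤1+n 2)) ls+3≤p)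
    n∤sl : ¬ n ∣ (s * l)
    n∤sl = ∤-between (s≤s z≤n) (subst (_< n) (ℕP.*-comm l s) (ℕP.<-≤-trans (ℕP.m<m+n (l * s) (s≤s z≤n)) ls+2≤n))
    n∤ks+1 : (k : ℕ) → 1 ≤ k → k ≤ l → ¬ n ∣ (k * s + 1)
    n∤ks+1 k _ k≤l = ∤-between (subst (0 <_) (ℕP.+-comm 1 (k * s)) (s≤s z≤n))
      (ℕP.<-≤-trans (ℕP.+-mono-≤-< (ℕP.*-monoˡ-≤ s k≤l) (ℕP.n<1+n 1)) ls+2≤n)

  p^par∣⇒p∣ : ∀ m {q} → p^ par m ∣ q → p^ 1 ∣ q
  p^par∣⇒p∣ m q∣ with par m | par≡1⊎par≡2 m
  ... | _ | inj₁ refl = q∣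
  ... | _ | inj₂ refl = ∣-pred q∣

  H-S-congruence : ∀ s l → l + 2 ≤ p → ¬ (n ∣ (s * l)) → ((k : ℕ) → 1 ≤ k → k ≤ l → ¬ (n ∣ (k * s + 1))) →
    (H (rep s l) n ≡0mod (p ^ par (l * s ∸ 1))) × (S (rep s l) n ≡0mod (p ^ par (l * s ∸ 1)))
  H-S-congruence s l l+2≤p n∤sl n∤ks+1 = Product.map p^∣⇒≡0mod p^∣⇒≡0mod (H∣×S∣ s l l+2≤p n∤sl n∤ks+1)

  H-S-congruence-large-p : ∀ s l → 1 ≤ s → 1 ≤ l → l * s + 3 ≤ p →
    ((H (rep s l) n ≡0mod (p ^ par (l * s ∸ 1))) × (S (rep s l) n ≡0mod (p ^ par (l * s ∸ 1)))) × (H (rep s l) n ≡0mod p)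
  H-S-congruence-large-p s l 1≤s 1≤l ls+3≤p with large-p-hypotheses s l 1≤s 1≤l ls+3≤p
  ... | l+2≤p , n∤sl , n∤ks+1 =
    H-S-congruence s l l+2≤p n∤sl n∤ks+1 ,
    subst (H (rep s l) n ≡0mod_) (ℕP.*-identityʳ p) (p^∣⇒≡0mod (p^par∣⇒p∣ (l * s ∸ 1) (proj₁ (H∣×S∣ s l l+2≤p n∤sl n∤ks+1))))

open import Defs using (H; S; rep; par; _≡0mod_)
open import Data.Nat using (_+_; _*_; _^_)
open import Data.Nat.Divisibility using (_∣_; ∣-refl)

theorem2p14 : (s l p : ℕ) → 1 ≤ s → 1 ≤ l → Prime p → ¬ (2 ∣ p) →
  ((l + 2 ≤ p) → ¬ ((p ∸ 1) ∣ (s * l)) →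
    ((k : ℕ) → 1 ≤ k → k ≤ l → ¬ ((p ∸ 1) ∣ (k * s + 1))) →
    (H (rep s l) (p ∸ 1) ≡0mod (p ^ par (l * s ∸ 1)))
      × (S (rep s l) (p ∸ 1) ≡0mod (p ^ par (l * s ∸ 1))))
  × ((l * s + 3 ≤ p) →
    ((H (rep s l) (p ∸ 1) ≡0mod (p ^ par (l * s ∸ 1)))
      × (S (rep s l) (p ∸ 1) ≡0mod (p ^ par (l * s ∸ 1))))
      × (H (rep s l) (p ∸ 1) ≡0mod p))
theorem2p14 s l 0 _ _ () _
theorem2p14 s l 1 _ _ () _
theorem2p14 s l 2 _ _ _ 2∤2 = ⊥-elim (2∤2 ∣-refl)
theorem2p14 s l (suc (suc (suc n″))) 1≤s 1≤l p-prime _ =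
  H-S-congruence s l , H-S-congruence-large-p s l 1≤s 1≤l
  where open OddPrime n″ p-prime
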